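{- Let $m\geq 2$ be even. A centered 4-gon has two edges with positive sign and two edges with negative sign, and the two edges with the same sign are opposite to each other. Consequently, applying a centered flip to any non-crossing perfect matching $M$ changes its weight $w(M)$ by $-(m-2)$ if the two edges with negative sign enter in this flip, and by $+(m-2)$ if the two edges with positive sign enter in this flip. Along any sequence of consecutive centered flips, flips of these two kinds alternate.
   Context: Let $n=2m$ points be equally spaced on a unit circle centered at the origin, labeled clockwise $1,\dots,n$. $E_m=\{\{i,j\}: i,j\in[n],\ j-i\text{ odd}\}$ (for $m$ even no such edge passes through the origin). Non-crossing perfect matchings on these points are considered; a flip replaces two edges $\{a,b\},\{c,d\}$ of a matching by $\{a,c\},\{b,d\}$, producing a non-crossing perfect matching. The length $\ell(e)$ of $e=\{i,j\}\in E_m$ is the minimum over the two sides of $e$ of (number of points strictly on that side)$/2$. A centered 4-gon is a convex quadrilateral whose four sides are edges from $E_m$ with lengths summing to $m-2$; a centered flip is a flip whose quadrilateral (formed by the two removed and two added edges) is a centered 4-gon. For an edge $e\in E_m$ with endpoints $i,j$ named so that the origin lies to the right of the ray from $i$ to $j$, $\mathrm{sgn}(e)=+1$ if $i$ is odd and $-1$ if $i$ is even. The weight of a matching $M$ is $w(M)=\sum_{e\in M}\mathrm{sgn}(e)\,\ell(e)$. -}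

module Defs where

open import Data.Nat as ℕ using (ℕ; zero; suc; _+_; _*_; _∸_; _⊓_; ⌊_/2⌋; ∣_-_∣; _≤_; _%_; _≡ᵇ_; _<ᵇ_)
open import Data.Nat.Divisibility using (_∣_)
open import Data.Integer as ℤ using (ℤ; +_; -_)
open import Data.Fin as Fin using (Fin; toℕ)
open import Data.List using (List; foldr)
open import Data.Fin.Base using () renaming (_<_ to _<ᶠ_)
open import Data.List using () renaming (allFin to allFinL)
open import Data.Product using (_×_; Σ; ∃; ∃-syntax)
open import Data.Sum using (_⊎_)
open import Data.Bool using (if_then_else_)
open import Relation.Nullary using (¬_)
open import Relation.Binary.PropositionalEquality using (_≡_; _≢_)

N : ℕ → ℕ
N m = 2 * m

-- the points; Fin (2m) index i carries the label i+1 ∈ {1,…,2m} (clockwise)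
Pt : ℕ → Set
Pt m = Fin (N m)

module _ (m : ℕ) where

  lab : Pt m → ℕ
  lab i = suc (toℕ i)

  InE : Pt m → Pt m → Set
  InE i j = ¬ (2 ∣ ∣ lab i - lab j ∣)

  -- length: min over the two sides of (#points strictly on that side)/2
  len : Pt m → Pt m → ℕ
  len i j = ⌊ ((d ∸ 1) ⊓ (N m ∸ d ∸ 1)) /2⌋
    where d = ∣ lab i - lab j ∣

  cwDist : Pt m → Pt m → ℕ
  cwDist i j = if lab i ℕ.≤ᵇ lab j then lab j ∸ lab i else N m ∸ (lab i ∸ lab j)

  -- the tail of the edge {i,j} oriented so that the origin lies to the right of
  -- the ray tail → head: with clockwise labelling this is the endpoint from which
  -- the other one is reached clockwise in fewer than m steps
  tail : Pt m → Pt m → Pt m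
  tail i j = if cwDist i j <ᵇ m then i else j

  sgn : Pt m → Pt m → ℤ
  sgn i j = if (lab (tail i j) % 2) ≡ᵇ 1 then + 1 else - (+ 1)

  Btw : Pt m → Pt m → Pt m → Set
  Btw a b x = (a <ᶠ x × x <ᶠ b) ⊎ (b <ᶠ x × x <ᶠ a)

  Cross : Pt m → Pt m → Pt m → Pt m → Set
  Cross a b c d =
    (Btw a b c × ¬ Btw a b d × d ≢ a × d ≢ b) ⊎ (Btw a b d × ¬ Btw a b c × c ≢ a × c ≢ b)

  record NCMatching : Set where
    field
      μ        : Pt m → Pt m
      invol    : ∀ i → μ (μ i) ≡ i
      nofix    : ∀ i → μ i ≢ i
      noncross : ∀ i j → ¬ Cross i (μ i) j (μ j)

  -- weight  w(M) = Σ_{e ∈ M} sgn(e) ℓ(e)   (each edge {i, μ i} counted once, at i < μ i)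
  w : NCMatching → ℤ
  w M = foldr (λ i acc → contrib i ℤ.+ acc) (+ 0) (allFinL (N m))
    where
    contrib : Pt m → ℤ
    contrib i = if toℕ i <ᵇ toℕ (NCMatching.μ M i) then sgn i (NCMatching.μ M i) ℤ.* + len i (NCMatching.μ M i) else + 0

  Flip : NCMatching → NCMatching → Pt m → Pt m → Pt m → Pt m → Set
  Flip M M' a b c d =
    NCMatching.μ M a ≡ b × NCMatching.μ M c ≡ d × NCMatching.μ M' a ≡ c × NCMatching.μ M' b ≡ d ×
    (a ≢ c × a ≢ d × b ≢ c × b ≢ d) ×
    (∀ v → v ≢ a → v ≢ b → v ≢ c → v ≢ d → NCMatching.μ M' v ≡ NCMatching.μ M v)

  Inc4 : Pt m → Pt m → Pt m → Pt m → Set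
  Inc4 a b c d = a <ᶠ b × b <ᶠ c × c <ᶠ d

  -- p,q,r,s are the vertices of a convex quadrilateral, in this cyclic order
  -- (clockwise or counterclockwise), with sides pq, qr, rs, sp
  ConvexQuad : Pt m → Pt m → Pt m → Pt m → Set
  ConvexQuad p q r s =
    Inc4 p q r s ⊎ Inc4 q r s p ⊎ Inc4 r s p q ⊎ Inc4 s p q r ⊎
    Inc4 s r q p ⊎ Inc4 r q p s ⊎ Inc4 q p s r ⊎ Inc4 p s r q

  Centered4gon : Pt m → Pt m → Pt m → Pt m → Set
  Centered4gon p q r s =
    ConvexQuad p q r s × InE p q × InE q r × InE r s × InE s p ×
    len p q + len q r + len r s + len s p ≡ m ∸ 2

  CenteredFlip : NCMatching → NCMatching → Pt m → Pt m → Pt m → Pt m → Set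
  CenteredFlip M M' a b c d = Flip M M' a b c d × Centered4gon a b d c

module Submission where

-- Sort the vertices w < x < y < z of a centred 4-gon by position. All four gaps, including the
-- wrap-around one, are odd, and a chord with gap d = 2h + 1 has length at most h; since the h's
-- add up to m - 2, every gap must be shorter than m. Hence wx, xy, yz are short chords, whose sign
-- is that of their first vertex, and zw is long, with the sign of z; as the vertex parities
-- alternate, opposite sides share a sign and adjacent ones differ. A centred flip therefore
-- changes the weight by the common sign of the entering edges times the total length m - 2.
-- For alternation, the vertices of a centred 4-gon lie in no closed minor arc, so the edges added
-- by one flip and those removed by the next bound the face of the middle matching containing the
-- centre; all edges of that face have the same sign, because the points between consecutive ones
-- are matched among themselves and so consecutive boundary vertices have opposite parity.

open import Defs
open import Data.Nat using (ℕ; zero; suc; _+_; _*_; _∸_; _≤_; _<_; _<?_; _≤?_; _⊓_; ⌊_/2⌋; z≤n; s≤s; ∣_-_∣; _%_; _≡ᵇ_; _<ᵇ_; _≤ᵇ_; parity)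
open import Data.Nat.Properties
open import Data.Nat.Divisibility using (_∣_; divides)
open import Data.Parity.Base as ℙ using (Parity; 0ℙ; 1ℙ; _⁻¹)
open import Data.Parity.Properties as ℙₚ using (+-homo-+; *-homo-*; suc-homo-⁻¹; p+p≡0ℙ; p≢p⁻¹; ⁻¹-selfInverse; ⁻¹-involutive)
open import Data.Integer as ℤ using (ℤ; +_; -_)
open import Data.Bool using (true; false; if_then_else_; T)
open import Data.Fin as Fin using (Fin; toℕ)
open import Data.Fin.Properties as Finₚ using (toℕ<n; toℕ-injective; toℕ-fromℕ<)
open import Data.Product using (_×_; _,_; proj₁; proj₂; ∃; map)
open import Data.Sum using (_⊎_; inj₁; inj₂)
open import Data.Empty using (⊥; ⊥-elim)
open import Relation.Nullary using (¬_; yes; no; Dec)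
open import Relation.Nullary.Decidable using (_×-dec_; _⊎-dec_)
open import Relation.Binary.PropositionalEquality
open import Relation.Binary using (tri<; tri≈; tri>)
open import Function using (_∘_)
open import Data.Nat.Tactic.RingSolver using (solve-∀)
import Data.Integer.Tactic.RingSolver as ℤ-Solver
import Data.Integer.Properties as ℤₚ
open import Data.List using (List; []; _∷_; foldr; tabulate)
open import Data.List.Membership.Propositional using (_∉_)
open import Data.List.Relation.Unary.All using (All; []; _∷_)
open import Data.List.Relation.Unary.Any using (here; there)
open import Data.List.Relation.Unary.AllPairs using ([]; _∷_)
open import Data.List.Relation.Unary.Unique.Propositional using (Unique)
open import Data.Vec.Functional using (Vector; updateAt)
open import Data.Vec.Functional.Properties using (updateAt-updates; updateAt-minimal)
open import Algebra.Properties.CommutativeMonoid.Sum ℤₚ.+-0-commutativeMonoid using (sum; sum-cong-≗)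

odd⇒suc-double : ∀ {d} → ¬ 2 ∣ d → ∃ λ h → d ≡ suc (h + h)
odd⇒suc-double {0} ¬2∣d = ⊥-elim (¬2∣d (divides 0 refl))
odd⇒suc-double {1} _ = 0 , refl
odd⇒suc-double {suc (suc d)} ¬2∣d with odd⇒suc-double {d} (λ { (divides q eq) → ¬2∣d (divides (suc q) (cong (suc ∘ suc) eq)) })
... | h , refl = suc h , cong suc (sym (+-suc (suc h) h))

parity-suc : ∀ n → parity (suc n) ≡ parity n ⁻¹
parity-suc n = sym (⁻¹-selfInverse (suc-homo-⁻¹ n))

parity-double : ∀ h → parity (h + h) ≡ 0ℙ
parity-double h = trans (+-homo-+ h h) (p+p≡0ℙ (parity h))

parity-odd : ∀ {d} → ¬ 2 ∣ d → parity d ≡ 1ℙ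
parity-odd ¬2∣d with odd⇒suc-double ¬2∣d
... | h , refl = trans (parity-suc (h + h)) (cong _⁻¹ (parity-double h))

even⇒parity≡0ℙ : ∀ {n} → 2 ∣ n → parity n ≡ 0ℙ
even⇒parity≡0ℙ (divides q refl) = trans (*-homo-* q 2) (proj₂ ℙₚ.*-zero (parity q))

parity-∸ : ∀ {a b} → a ≤ b → parity b ≡ parity a ℙ.+ parity (b ∸ a)
parity-∸ {a} {b} a≤b = trans (cong parity (sym (m+[n∸m]≡n a≤b))) (+-homo-+ a (b ∸ a))

odd-gap⇒parity⁻¹ : ∀ {a b} → a ≤ b → ¬ 2 ∣ (b ∸ a) → parity b ≡ parity a ⁻¹
odd-gap⇒parity⁻¹ {a} {b} a≤b odd = begin
  parity b                   ≡⟨ parity-∸ a≤b ⟩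
  parity a ℙ.+ parity (b ∸ a) ≡⟨ cong (parity a ℙ.+_) (parity-odd odd) ⟩
  parity a ℙ.+ 1ℙ             ≡⟨ ℙₚ.+-comm (parity a) 1ℙ ⟩
  parity a ⁻¹                ∎
  where open ≡-Reasoning

flip-sym : ∀ {p q : Parity} → q ≡ p ⁻¹ → p ≡ q ⁻¹
flip-sym q≡p⁻¹ = sym (⁻¹-selfInverse (sym q≡p⁻¹))

flip-flip : ∀ {p q r : Parity} → q ≡ p ⁻¹ → r ≡ q ⁻¹ → r ≡ p
flip-flip {p} refl refl = ⁻¹-involutive p

signOf : Parity → ℤ
signOf 0ℙ = + 1
signOf 1ℙ = - (+ 1)

signOf-⁻¹ : ∀ p → signOf (p ⁻¹) ≡ - signOf p
signOf-⁻¹ 0ℙ = refl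
signOf-⁻¹ 1ℙ = refl

signOf≢-signOf : ∀ p → signOf p ≢ - signOf p
signOf≢-signOf 0ℙ ()
signOf≢-signOf 1ℙ ()

-- The label of the point at position n is suc n, odd exactly when n is even.
label-sign : ∀ n → (if (suc n % 2 ≡ᵇ 1) then + 1 else - (+ 1)) ≡ signOf (parity n)
label-sign 0 = refl
label-sign 1 = refl
label-sign (suc (suc n)) = label-sign n

if-<ᵇ-true : ∀ {A : Set} {a b} {x y : A} → a < b → (if a <ᵇ b then x else y) ≡ x
if-<ᵇ-true {a = a} {b} a<b with a <ᵇ b | <⇒<ᵇ a<b
... | true | _ = refl

if-<ᵇ-false : ∀ {A : Set} {a b} {x y : A} → b ≤ a → (if a <ᵇ b then x else y) ≡ y
if-<ᵇ-false {a = a} {b} b≤a with a <ᵇ b in eq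
... | false = refl
... | true = ⊥-elim (<⇒≱ (<ᵇ⇒< a b (subst T (sym eq) _)) b≤a)

⌊n+n/2⌋≡n : ∀ n → ⌊ n + n /2⌋ ≡ n
⌊n+n/2⌋≡n zero = refl
⌊n+n/2⌋≡n (suc n) rewrite +-suc n n = cong suc (⌊n+n/2⌋≡n n)

≤⌊n/2⌋⇒double≤ : ∀ {k n} → k ≤ ⌊ n /2⌋ → k + k ≤ n
≤⌊n/2⌋⇒double≤ {zero} _ = z≤n
≤⌊n/2⌋⇒double≤ {suc k} {suc (suc n)} (s≤s k≤n/2) rewrite +-suc k k = s≤s (s≤s (≤⌊n/2⌋⇒double≤ k≤n/2))

double≤⇒≤ : ∀ {a b} → a + a ≤ b + b → a ≤ b
double≤⇒≤ {a} {b} 2a≤2b with a ≤? b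
... | yes a≤b = a≤b
... | no a≰b = ⊥-elim (<⇒≱ (+-mono-< (≰⇒> a≰b) (≰⇒> a≰b)) 2a≤2b)

≤∸⇒+≤ : ∀ {k n o} → 0 < k → k ≤ n ∸ o → k + o ≤ n
≤∸⇒+≤ {k} {n} {o} 0<k k≤n∸o with o ≤? n
... | yes o≤n = ≤-trans (+-monoˡ-≤ o k≤n∸o) (≤-reflexive (m∸n+n≡m o≤n))
... | no o≰n = ⊥-elim (<⇒≱ 0<k (subst (k ≤_) (m≤n⇒m∸n≡0 (<⇒≤ (≰⇒> o≰n))) k≤n∸o))

+-tight : ∀ {a b A B} → a ≤ A → b ≤ B → a + b ≡ A + B → a ≡ A × b ≡ B
+-tight {a} {b} {A} {B} a≤A b≤B a+b≡A+B = ≤-antisym a≤A A≤a , ≤-antisym b≤B B≤b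
  where
  A≤a : A ≤ a
  A≤a = +-cancelʳ-≤ b A a (≤-trans (+-monoʳ-≤ A b≤B) (≤-reflexive (sym a+b≡A+B)))
  B≤b : B ≤ b
  B≤b = +-cancelˡ-≤ a B b (≤-trans (+-monoˡ-≤ B a≤A) (≤-reflexive (sym a+b≡A+B)))

+-tight₄ : ∀ {a b c d A B C D} → a ≤ A → b ≤ B → c ≤ C → d ≤ D → a + b + c + d ≡ A + B + C + D →
           a ≡ A × b ≡ B × c ≡ C × d ≡ D
+-tight₄ a≤A b≤B c≤C d≤D sum≡ with +-tight (+-mono-≤ (+-mono-≤ a≤A b≤B) c≤C) d≤D sum≡
... | abc≡ , d≡D with +-tight (+-mono-≤ a≤A b≤B) c≤C abc≡
...   | ab≡ , c≡C with +-tight a≤A b≤B ab≡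
...     | a≡A , b≡B = a≡A , b≡B , c≡C , d≡D

∸-telescope : ∀ {a b c} → a ≤ b → b ≤ c → b ∸ a + (c ∸ b) ≡ c ∸ a
∸-telescope {a} {b} {c} a≤b b≤c = begin
  b ∸ a + (c ∸ b) ≡⟨ +-comm (b ∸ a) (c ∸ b) ⟩
  c ∸ b + (b ∸ a) ≡⟨ sym (+-∸-assoc (c ∸ b) a≤b) ⟩
  c ∸ b + b ∸ a   ≡⟨ cong (_∸ a) (m∸n+n≡m b≤c) ⟩
  c ∸ a           ∎
  where open ≡-Reasoning

∸<⇒<+ : ∀ {a b k} → a ≤ b → b ∸ a < k → b < a + k
∸<⇒<+ {a} a≤b b∸a<k = subst (_< a + _) (m+[n∸m]≡n a≤b) (+-monoʳ-< a b∸a<k)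

<∸⇒+< : ∀ {a b k} → a ≤ b → k < b ∸ a → a + k < b
<∸⇒+< {a} a≤b k<b∸a = subst (a + _ <_) (m+[n∸m]≡n a≤b) (+-monoʳ-< a k<b∸a)

sumAt : ∀ {n} → Vector ℤ n → List (Fin n) → ℤ
sumAt f = foldr (λ i acc → f i ℤ.+ acc) (+ 0)

sum-agree-off : ∀ {n} {f g : Vector ℤ n} i → (∀ j → j ≢ i → f j ≡ g j) → sum f ℤ.+ g i ≡ sum g ℤ.+ f i
sum-agree-off {suc n} {f} {g} Fin.zero agree = begin
  f Fin.zero ℤ.+ sum (f ∘ Fin.suc) ℤ.+ g Fin.zero ≡⟨ cong (λ t → f Fin.zero ℤ.+ t ℤ.+ g Fin.zero) (sum-cong-≗ (λ j → agree (Fin.suc j) (λ ()))) ⟩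
  f Fin.zero ℤ.+ sum (g ∘ Fin.suc) ℤ.+ g Fin.zero ≡⟨ swap (f Fin.zero) (sum (g ∘ Fin.suc)) (g Fin.zero) ⟩
  g Fin.zero ℤ.+ sum (g ∘ Fin.suc) ℤ.+ f Fin.zero ∎
  where
  open ≡-Reasoning
  swap : ∀ x y z → x ℤ.+ y ℤ.+ z ≡ z ℤ.+ y ℤ.+ x
  swap = ℤ-Solver.solve-∀
sum-agree-off {suc n} {f} {g} (Fin.suc i) agree = begin
  f Fin.zero ℤ.+ sum (f ∘ Fin.suc) ℤ.+ g (Fin.suc i)   ≡⟨ ℤₚ.+-assoc (f Fin.zero) _ _ ⟩
  f Fin.zero ℤ.+ (sum (f ∘ Fin.suc) ℤ.+ g (Fin.suc i))
    ≡⟨ cong₂ ℤ._+_ (agree Fin.zero (λ ())) (sum-agree-off i (λ j j≢i → agree (Fin.suc j) (j≢i ∘ Finₚ.suc-injective))) ⟩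
  g Fin.zero ℤ.+ (sum (g ∘ Fin.suc) ℤ.+ f (Fin.suc i)) ≡⟨ sym (ℤₚ.+-assoc (g Fin.zero) _ _) ⟩
  g Fin.zero ℤ.+ sum (g ∘ Fin.suc) ℤ.+ f (Fin.suc i)   ∎
  where open ≡-Reasoning

sum-agree-off-list : ∀ {n} {f g : Vector ℤ n} (ps : List (Fin n)) → Unique ps → (∀ j → j ∉ ps → f j ≡ g j) →
                     sum f ℤ.+ sumAt g ps ≡ sum g ℤ.+ sumAt f ps
sum-agree-off-list {f = f} {g} [] _ agree = cong (ℤ._+ + 0) (sum-cong-≗ (λ j → agree j (λ ())))
sum-agree-off-list {f = f} {g} (p ∷ ps) (p∉ps ∷ unique) agree = begin
  sum f ℤ.+ (g p ℤ.+ sumAt g ps)  ≡⟨ sym (ℤₚ.+-assoc (sum f) _ _) ⟩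
  sum f ℤ.+ g p ℤ.+ sumAt g ps    ≡⟨ cong (λ t → sum f ℤ.+ t ℤ.+ sumAt g ps) (sym (updateAt-updates p f)) ⟩
  sum f ℤ.+ h p ℤ.+ sumAt g ps    ≡⟨ cong (ℤ._+ sumAt g ps) (sum-agree-off {f = f} {h} p f≈h) ⟩
  sum h ℤ.+ f p ℤ.+ sumAt g ps    ≡⟨ swap (sum h) (f p) (sumAt g ps) ⟩
  sum h ℤ.+ sumAt g ps ℤ.+ f p    ≡⟨ cong (ℤ._+ f p) (sum-agree-off-list ps unique h≈g) ⟩
  sum g ℤ.+ sumAt h ps ℤ.+ f p    ≡⟨ cong (λ t → sum g ℤ.+ t ℤ.+ f p) (sumAt-cong p∉ps) ⟩
  sum g ℤ.+ sumAt f ps ℤ.+ f p    ≡⟨ swap′ (sum g) (sumAt f ps) (f p) ⟩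
  sum g ℤ.+ (f p ℤ.+ sumAt f ps)  ∎
  where
  open ≡-Reasoning
  h : Vector ℤ _
  h = updateAt f p (λ _ → g p)
  f≈h : ∀ j → j ≢ p → f j ≡ h j
  f≈h j j≢p = sym (updateAt-minimal j p f j≢p)
  h≈g : ∀ j → j ∉ ps → h j ≡ g j
  h≈g j j∉ps with j Fin.≟ p
  ... | yes refl = updateAt-updates p f
  ... | no j≢p = trans (updateAt-minimal j p f j≢p) (agree j λ { (here j≡p) → j≢p j≡p ; (there j∈ps) → j∉ps j∈ps })
  sumAt-cong : ∀ {qs} → All (p ≢_) qs → sumAt h qs ≡ sumAt f qs
  sumAt-cong [] = refl
  sumAt-cong {q ∷ _} (p≢q ∷ p∉qs) = cong₂ ℤ._+_ (updateAt-minimal q p f (p≢q ∘ sym)) (sumAt-cong p∉qs)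
  swap : ∀ x y z → x ℤ.+ y ℤ.+ z ≡ x ℤ.+ z ℤ.+ y
  swap = ℤ-Solver.solve-∀
  swap′ : ∀ x y z → x ℤ.+ y ℤ.+ z ≡ x ℤ.+ (z ℤ.+ y)
  swap′ = ℤ-Solver.solve-∀

sumAt-tabulate : ∀ {k n} (f : Vector ℤ n) (g : Fin k → Fin n) → sumAt f (tabulate g) ≡ sum (f ∘ g)
sumAt-tabulate {zero} f g = refl
sumAt-tabulate {suc k} f g = cong (λ t → f (g Fin.zero) ℤ.+ t) (sumAt-tabulate f (g ∘ Fin.suc))

pos-+₄ : ∀ a b c d → + (a + b + c + d) ≡ + a ℤ.+ + b ℤ.+ + c ℤ.+ + d
pos-+₄ a b c d = trans (ℤₚ.pos-+ (a + b + c) d) (cong (ℤ._+ + d) (trans (ℤₚ.pos-+ (a + b) c) (cong (ℤ._+ + c) (ℤₚ.pos-+ a b))))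

exchange-signs : ∀ W′ W s A B C D → W′ ℤ.+ (- s ℤ.* A ℤ.+ - s ℤ.* B) ≡ W ℤ.+ (s ℤ.* C ℤ.+ s ℤ.* D) →
                 W′ ≡ W ℤ.+ s ℤ.* (A ℤ.+ B ℤ.+ C ℤ.+ D)
exchange-signs W′ W s A B C D eq = begin
  W′                                                 ≡⟨ cancel W′ (- s ℤ.* A ℤ.+ - s ℤ.* B) ⟩
  W′ ℤ.+ (- s ℤ.* A ℤ.+ - s ℤ.* B) ℤ.- (- s ℤ.* A ℤ.+ - s ℤ.* B) ≡⟨ cong (ℤ._- (- s ℤ.* A ℤ.+ - s ℤ.* B)) eq ⟩
  W ℤ.+ (s ℤ.* C ℤ.+ s ℤ.* D) ℤ.- (- s ℤ.* A ℤ.+ - s ℤ.* B) ≡⟨ collect W s A B C D ⟩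
  W ℤ.+ s ℤ.* (A ℤ.+ B ℤ.+ C ℤ.+ D)                  ∎
  where
  open ≡-Reasoning
  cancel : ∀ x y → x ≡ x ℤ.+ y ℤ.- y
  cancel = ℤ-Solver.solve-∀
  collect : ∀ W s A B C D → W ℤ.+ (s ℤ.* C ℤ.+ s ℤ.* D) ℤ.- (- s ℤ.* A ℤ.+ - s ℤ.* B) ≡ W ℤ.+ s ℤ.* (A ℤ.+ B ℤ.+ C ℤ.+ D)
  collect = ℤ-Solver.solve-∀

module _ (m : ℕ) where

  N≡m+m : N m ≡ m + m
  N≡m+m = cong (λ k → m + k) (+-identityʳ m)

  vertexSign : Pt m → ℤ
  vertexSign x = signOf (parity (toℕ x))

  sgn≡vertexSign-tail : ∀ i j → sgn m i j ≡ vertexSign (tail m i j)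
  sgn≡vertexSign-tail i j = label-sign (toℕ (tail m i j))

  cwDist-forward : ∀ {x y : Pt m} → toℕ x ≤ toℕ y → cwDist m x y ≡ toℕ y ∸ toℕ x
  cwDist-forward {x} {y} x≤y with suc (toℕ x) ≤ᵇ suc (toℕ y) in eq
  ... | true = refl
  ... | false = ⊥-elim (subst T eq (≤⇒≤ᵇ (s≤s x≤y)))

  cwDist-backward : ∀ {x y : Pt m} → toℕ x < toℕ y → cwDist m y x ≡ N m ∸ (toℕ y ∸ toℕ x)
  cwDist-backward {x} {y} x<y with suc (toℕ y) ≤ᵇ suc (toℕ x) in eq
  ... | false = refl
  ... | true = ⊥-elim (<⇒≱ x<y (≤-pred (≤ᵇ⇒≤ (suc (toℕ y)) (suc (toℕ x)) (subst T (sym eq) _))))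

  gap<m : ∀ {x y} → x ≤ y → y < x + m → y ∸ x < m
  gap<m {x} x≤y y<x+m = +-cancelˡ-< x _ _ (subst (_< x + m) (sym (m+[n∸m]≡n x≤y)) y<x+m)

  m<gap : ∀ {x y} → x ≤ y → x + m < y → m < y ∸ x
  m<gap {x} x≤y x+m<y = +-cancelˡ-< x _ _ (subst (x + m <_) (sym (m+[n∸m]≡n x≤y)) x+m<y)

  tail-short : ∀ {x y : Pt m} → toℕ x < toℕ y → toℕ y < toℕ x + m → tail m x y ≡ x × tail m y x ≡ x
  tail-short {x} {y} x<y short =
    trans (cong (λ d → if d <ᵇ m then x else y) (cwDist-forward (<⇒≤ x<y))) (if-<ᵇ-true g<m) ,
    trans (cong (λ d → if d <ᵇ m then y else x) (cwDist-backward x<y)) (if-<ᵇ-false m≤N∸g)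
    where
    g<m : toℕ y ∸ toℕ x < m
    g<m = gap<m (<⇒≤ x<y) short
    m≤N∸g : m ≤ N m ∸ (toℕ y ∸ toℕ x)
    m≤N∸g = begin
      m                           ≡⟨ sym (m+n∸n≡m m m) ⟩
      m + m ∸ m                   ≤⟨ ∸-monoʳ-≤ (m + m) (<⇒≤ g<m) ⟩
      m + m ∸ (toℕ y ∸ toℕ x)     ≡⟨ cong (_∸ (toℕ y ∸ toℕ x)) (sym N≡m+m) ⟩
      N m ∸ (toℕ y ∸ toℕ x)       ∎
      where open ≤-Reasoning

  tail-long : ∀ {x y : Pt m} → toℕ x < toℕ y → toℕ x + m < toℕ y → tail m x y ≡ y × tail m y x ≡ y
  tail-long {x} {y} x<y long =
    trans (cong (λ d → if d <ᵇ m then x else y) (cwDist-forward (<⇒≤ x<y))) (if-<ᵇ-false (<⇒≤ m<g)) ,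
    trans (cong (λ d → if d <ᵇ m then y else x) (cwDist-backward x<y)) (if-<ᵇ-true N∸g<m)
    where
    m<g : m < toℕ y ∸ toℕ x
    m<g = m<gap (<⇒≤ x<y) long
    N∸g<m : N m ∸ (toℕ y ∸ toℕ x) < m
    N∸g<m = begin-strict
      N m ∸ (toℕ y ∸ toℕ x)   ≡⟨ cong (_∸ (toℕ y ∸ toℕ x)) N≡m+m ⟩
      m + m ∸ (toℕ y ∸ toℕ x) <⟨ ∸-monoʳ-< m<g g≤m+m ⟩
      m + m ∸ m               ≡⟨ m+n∸n≡m m m ⟩
      m                       ∎
      where
      open ≤-Reasoning
      g≤m+m : toℕ y ∸ toℕ x ≤ m + m
      g≤m+m = subst (toℕ y ∸ toℕ x ≤_) N≡m+m (≤-trans (m∸n≤m (toℕ y) (toℕ x)) (<⇒≤ (toℕ<n y)))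

  sgn-short : ∀ {x y : Pt m} → toℕ x < toℕ y → toℕ y < toℕ x + m → sgn m x y ≡ vertexSign x × sgn m y x ≡ vertexSign x
  sgn-short {x} {y} x<y short with tail-short x<y short
  ... | xy , yx = trans (sgn≡vertexSign-tail x y) (cong vertexSign xy) , trans (sgn≡vertexSign-tail y x) (cong vertexSign yx)

  sgn-long : ∀ {x y : Pt m} → toℕ x < toℕ y → toℕ x + m < toℕ y → sgn m x y ≡ vertexSign y × sgn m y x ≡ vertexSign y
  sgn-long {x} {y} x<y long with tail-long x<y long
  ... | xy , yx = trans (sgn≡vertexSign-tail x y) (cong vertexSign xy) , trans (sgn≡vertexSign-tail y x) (cong vertexSign yx)

  InE-parity : ∀ {x y : Pt m} → InE m x y → parity (toℕ y) ≡ parity (toℕ x) ⁻¹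
  InE-parity {x} {y} odd with ≤-total (toℕ x) (toℕ y)
  ... | inj₁ x≤y = odd-gap⇒parity⁻¹ x≤y (odd ∘ subst (2 ∣_) (sym (m≤n⇒∣m-n∣≡n∸m x≤y)))
  ... | inj₂ y≤x = flip-sym (odd-gap⇒parity⁻¹ y≤x (odd ∘ subst (2 ∣_) (sym (m≤n⇒∣n-m∣≡n∸m y≤x))))

  module _ (m-even : parity m ≡ 0ℙ) where

    parity-+m : ∀ a → parity (a + m) ≡ parity a
    parity-+m a = trans (+-homo-+ a m) (trans (cong (parity a ℙ.+_) m-even) (proj₂ ℙₚ.+-identity (parity a)))

    sgn-comm-< : ∀ {x y : Pt m} → toℕ x < toℕ y → parity (toℕ y) ≡ parity (toℕ x) ⁻¹ → sgn m x y ≡ sgn m y x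
    sgn-comm-< {x} {y} x<y flips with <-cmp (toℕ y) (toℕ x + m)
    ... | tri< short _ _ = trans (proj₁ (sgn-short x<y short)) (sym (proj₂ (sgn-short x<y short)))
    ... | tri> _ _ long = trans (proj₁ (sgn-long x<y long)) (sym (proj₂ (sgn-long x<y long)))
    ... | tri≈ _ diametral _ =
      ⊥-elim (p≢p⁻¹ (parity (toℕ x)) (trans (sym (trans (cong parity diametral) (parity-+m (toℕ x)))) flips))

    sgn-comm : ∀ {x y : Pt m} → parity (toℕ y) ≡ parity (toℕ x) ⁻¹ → sgn m x y ≡ sgn m y x
    sgn-comm {x} {y} flips with <-cmp (toℕ x) (toℕ y)
    ... | tri< x<y _ _ = sgn-comm-< x<y flips
    ... | tri≈ _ x≡y _ = cong₂ (sgn m) (toℕ-injective x≡y) (sym (toℕ-injective x≡y))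
    ... | tri> _ _ y<x = sym (sgn-comm-< y<x (flip-sym flips))

  Btw⇒inside : ∀ {a b v : Pt m} → toℕ a < toℕ b → Btw m a b v → toℕ a < toℕ v × toℕ v < toℕ b
  Btw⇒inside a<b (inj₁ inside) = inside
  Btw⇒inside a<b (inj₂ (b<v , v<a)) = ⊥-elim (<-asym a<b (<-trans b<v v<a))

  -- The arc cut off by the chord between positions Y < Z on the side away from the centre
  -- (well defined for chords of odd length, which are never diameters), open and closed.
  MinorArc : ℕ → ℕ → ℕ → Set
  MinorArc Y Z v = (Z < Y + m × Y < v × v < Z) ⊎ (Y + m < Z × (v < Y ⊎ Z < v))

  ClosedMinorArc : ℕ → ℕ → ℕ → Set
  ClosedMinorArc Y Z v = (Z < Y + m × Y ≤ v × v ≤ Z) ⊎ (Y + m < Z × (v ≤ Y ⊎ Z ≤ v))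

  closedMinorArc? : ∀ Y Z v → Dec (ClosedMinorArc Y Z v)
  closedMinorArc? Y Z v = (Z <? Y + m ×-dec (Y ≤? v ×-dec v ≤? Z)) ⊎-dec (Y + m <? Z ×-dec (v ≤? Y ⊎-dec Z ≤? v))

  minorArc⇒closed : ∀ {Y Z v} → MinorArc Y Z v → ClosedMinorArc Y Z v
  minorArc⇒closed (inj₁ (short , Y<v , v<Z)) = inj₁ (short , <⇒≤ Y<v , <⇒≤ v<Z)
  minorArc⇒closed (inj₂ (long , inj₁ v<Y)) = inj₂ (long , inj₁ (<⇒≤ v<Y))
  minorArc⇒closed (inj₂ (long , inj₂ Z<v)) = inj₂ (long , inj₂ (<⇒≤ Z<v))

  minorArc-avoids-ends : ∀ {Y Z v} → Y < Z → MinorArc Y Z v → v ≢ Y × v ≢ Z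
  minorArc-avoids-ends _ (inj₁ (_ , Y<v , v<Z)) = (λ { refl → <-irrefl refl Y<v }) , (λ { refl → <-irrefl refl v<Z })
  minorArc-avoids-ends Y<Z (inj₂ (_ , inj₁ v<Y)) = (λ { refl → <-irrefl refl v<Y }) , (λ { refl → <-asym Y<Z v<Y })
  minorArc-avoids-ends Y<Z (inj₂ (_ , inj₂ Z<v)) = (λ { refl → <-asym Y<Z Z<v }) , (λ { refl → <-irrefl refl Z<v })

  closedMinorArc-ends : ∀ {Y Z v} → Y < Z → MinorArc Y Z v → ClosedMinorArc Y Z Y × ClosedMinorArc Y Z Z
  closedMinorArc-ends Y<Z (inj₁ (short , _)) = inj₁ (short , ≤-refl , <⇒≤ Y<Z) , inj₁ (short , <⇒≤ Y<Z , ≤-refl)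
  closedMinorArc-ends Y<Z (inj₂ (long , _)) = inj₂ (long , inj₁ ≤-refl) , inj₂ (long , inj₂ ≤-refl)

  minorArc-cross : ∀ {y z v u : Pt m} → toℕ y < toℕ z → MinorArc (toℕ y) (toℕ z) (toℕ v) →
                   ¬ ClosedMinorArc (toℕ y) (toℕ z) (toℕ u) → Cross m y z v u
  minorArc-cross {y} {z} {v} {u} y<z v-in u-out with v-in
  ... | inj₁ (short , y<v , v<z) =
    inj₁ (inj₁ (y<v , v<z) , (λ btw → u-out (inj₁ (short , map <⇒≤ <⇒≤ (Btw⇒inside y<z btw)))) ,
          (λ { refl → u-out (proj₁ ends) }) , (λ { refl → u-out (proj₂ ends) }))
    where
    ends : ClosedMinorArc (toℕ y) (toℕ z) (toℕ y) × ClosedMinorArc (toℕ y) (toℕ z) (toℕ z)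
    ends = closedMinorArc-ends y<z v-in
  ... | inj₂ (long , v-out) =
    inj₂ (inj₁ (≰⇒> (λ u≤y → u-out (inj₂ (long , inj₁ u≤y))) , ≰⇒> (λ z≤u → u-out (inj₂ (long , inj₂ z≤u)))) ,
          (λ btw → excluded v-out (Btw⇒inside y<z btw)) ,
          (λ { refl → proj₁ (minorArc-avoids-ends y<z v-in) refl }) , (λ { refl → proj₂ (minorArc-avoids-ends y<z v-in) refl }))
    where
    excluded : (toℕ v < toℕ y ⊎ toℕ z < toℕ v) → ¬ (toℕ y < toℕ v × toℕ v < toℕ z)
    excluded (inj₁ v<y) (y<v , _) = <-asym v<y y<v
    excluded (inj₂ z<v) (_ , v<z) = <-asym v<z z<v

  module _ (M : NCMatching m) where
    open NCMatching M

    μ-inverse : ∀ {x y} → μ x ≡ y → μ y ≡ x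
    μ-inverse {x} refl = invol x

    μ-injective : ∀ {x y} → μ x ≡ μ y → x ≡ y
    μ-injective {x} {y} eq = trans (sym (invol x)) (trans (cong μ eq) (invol y))

    nested : ∀ {y v} → toℕ y < toℕ v → toℕ v < toℕ (μ y) → toℕ y < toℕ (μ v) × toℕ (μ v) < toℕ (μ y)
    nested {y} {v} y<v v<μy with toℕ y <? toℕ (μ v) ×-dec toℕ (μ v) <? toℕ (μ y)
    ... | yes inside = inside
    ... | no outside = ⊥-elim (noncross y v (inj₁ (inj₁ (y<v , v<μy) , outside ∘ Btw⇒inside (<-trans y<v v<μy) , μv≢y , μv≢μy)))
      where
      μv≢y : μ v ≢ y
      μv≢y eq = <-irrefl (cong toℕ (sym (μ-inverse eq))) v<μy
      μv≢μy : μ v ≢ μ y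
      μv≢μy eq = <-irrefl (cong toℕ (sym (μ-injective eq))) y<v

    edge-closed : ∀ {y v} → toℕ y < toℕ (μ y) → toℕ y ≤ toℕ v → toℕ v ≤ toℕ (μ y) →
                  toℕ y ≤ toℕ (μ v) × toℕ (μ v) ≤ toℕ (μ y)
    edge-closed {y} {v} y<μy y≤v v≤μy with m≤n⇒m<n∨m≡n y≤v | m≤n⇒m<n∨m≡n v≤μy
    ... | inj₂ y≡v | _ with toℕ-injective y≡v
    ...   | refl = <⇒≤ y<μy , ≤-refl
    edge-closed {y} {v} y<μy y≤v v≤μy | inj₁ _ | inj₂ v≡μy
      rewrite μ-inverse (sym (toℕ-injective v≡μy)) = ≤-refl , <⇒≤ y<μy
    edge-closed {y} {v} y<μy y≤v v≤μy | inj₁ y<v | inj₁ v<μy = map <⇒≤ <⇒≤ (nested y<v v<μy)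

    edge-outside : ∀ {y v} → toℕ y < toℕ (μ y) → (toℕ v < toℕ y ⊎ toℕ (μ y) < toℕ v) →
                   toℕ (μ v) < toℕ y ⊎ toℕ (μ y) < toℕ (μ v)
    edge-outside {y} {v} y<μy v-out with toℕ (μ v) <? toℕ y | toℕ (μ y) <? toℕ (μ v)
    ... | yes μv<y | _ = inj₁ μv<y
    ... | no _ | yes μy<μv = inj₂ μy<μv
    ... | no μv≮y | no μy≮μv with edge-closed {y} {μ v} y<μy (≮⇒≥ μv≮y) (≮⇒≥ μy≮μv)
    ...   | y≤v , v≤μy rewrite invol v = ⊥-elim (excluded v-out)
      where
      excluded : ¬ (toℕ v < toℕ y ⊎ toℕ (μ y) < toℕ v)
      excluded (inj₁ v<y) = <⇒≱ v<y y≤v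
      excluded (inj₂ μy<v) = <⇒≱ μy<v v≤μy

    Stable : ℕ → ℕ → Set
    Stable a b = ∀ z → a ≤ toℕ z → toℕ z < b → a ≤ toℕ (μ z) × toℕ (μ z) < b

    -- The first point a of a stable [a, b) is matched to some u, splitting [a, b) into
    -- a, the stable interior (a, u) of that edge, u and the stable rest [u + 1, b).
    stable-parity-within : ∀ k {a b} → b ≤ a + k → b ≤ N m → a ≤ b → Stable a b → parity b ≡ parity a
    stable-parity-within k {a} {b} b≤a+k b≤N a≤b stable with m≤n⇒m<n∨m≡n a≤b
    ... | inj₂ refl = refl
    stable-parity-within zero {a} {b} b≤a+k b≤N a≤b stable | inj₁ a<b = ⊥-elim (<⇒≱ a<b (subst (b ≤_) (+-identityʳ a) b≤a+k))
    stable-parity-within (suc k) {a} {b} b≤a+k b≤N a≤b stable | inj₁ a<b = begin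
      parity b           ≡⟨ stable-parity-within k b≤u+1+k b≤N u<b stable-rest ⟩
      parity (suc u)     ≡⟨ parity-suc u ⟩
      parity u ⁻¹        ≡⟨ cong _⁻¹ (stable-parity-within k u≤a+1+k (<⇒≤ (<-≤-trans u<b b≤N)) a<u stable-interior) ⟩
      parity (suc a) ⁻¹  ≡⟨ cong _⁻¹ (parity-suc a) ⟩
      parity a ⁻¹ ⁻¹     ≡⟨ ⁻¹-involutive (parity a) ⟩
      parity a           ∎
      where
      open ≡-Reasoning
      z₀ : Pt m
      z₀ = Fin.fromℕ< (<-≤-trans a<b b≤N)
      z₀≡a : toℕ z₀ ≡ a
      z₀≡a = toℕ-fromℕ< _
      u : ℕ
      u = toℕ (μ z₀)
      a≤u×u<b : a ≤ u × u < b
      a≤u×u<b = stable z₀ (≤-reflexive (sym z₀≡a)) (subst (_< b) (sym z₀≡a) a<b)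
      u<b : u < b
      u<b = proj₂ a≤u×u<b
      a<u : a < u
      a<u = ≤∧≢⇒< (proj₁ a≤u×u<b) (λ a≡u → nofix z₀ (toℕ-injective (trans (sym a≡u) (sym z₀≡a))))
      z₀<u : toℕ z₀ < u
      z₀<u = subst (_< u) (sym z₀≡a) a<u
      u≤a+1+k : u ≤ suc a + k
      u≤a+1+k = <⇒≤ (<-≤-trans u<b (subst (b ≤_) (+-suc a k) b≤a+k))
      b≤u+1+k : b ≤ suc u + k
      b≤u+1+k = ≤-trans (subst (b ≤_) (+-suc a k) b≤a+k) (+-monoˡ-≤ k (<⇒≤ (s≤s a<u)))
      stable-interior : Stable (suc a) u
      stable-interior z a<z z<u with nested {z₀} {z} (subst (_< toℕ z) (sym z₀≡a) a<z) z<u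
      ... | z₀<μz , μz<u = subst (_< toℕ (μ z)) z₀≡a z₀<μz , μz<u
      stable-rest : Stable (suc u) b
      stable-rest z u<z z<b = beyond-u , proj₂ in-ab
        where
        in-ab : a ≤ toℕ (μ z) × toℕ (μ z) < b
        in-ab = stable z (≤-trans (<⇒≤ a<u) (<⇒≤ u<z)) z<b
        beyond-u : u < toℕ (μ z)
        beyond-u with u <? toℕ (μ z)
        ... | yes u<μz = u<μz
        ... | no u≮μz with edge-closed {z₀} {μ z} z₀<u (subst (_≤ toℕ (μ z)) (sym z₀≡a) (proj₁ in-ab)) (≮⇒≥ u≮μz)
        ...   | _ , z≤u rewrite invol z = ⊥-elim (<⇒≱ u<z z≤u)

    stable-parity : ∀ {a b} → b ≤ N m → a ≤ b → Stable a b → parity b ≡ parity a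
    stable-parity {a} b≤N = stable-parity-within (N m) (≤-trans b≤N (m≤n+m (N m) a)) b≤N

    edge-parity : ∀ {y} → toℕ y < toℕ (μ y) → parity (toℕ (μ y)) ≡ parity (toℕ y) ⁻¹
    edge-parity {y} y<μy = trans
      (stable-parity (<⇒≤ (toℕ<n (μ y))) y<μy (λ z → nested {y} {z}))
      (parity-suc (toℕ y))

    partner-parity : ∀ x → parity (toℕ (μ x)) ≡ parity (toℕ x) ⁻¹
    partner-parity x with <-cmp (toℕ x) (toℕ (μ x))
    ... | tri< x<μx _ _ = edge-parity x<μx
    ... | tri≈ _ x≡μx _ = ⊥-elim (nofix x (toℕ-injective (sym x≡μx)))
    ... | tri> _ _ μx<x = flip-sym (subst (λ t → parity (toℕ t) ≡ parity (toℕ (μ x)) ⁻¹) (invol x)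
                             (edge-parity {μ x} (subst (λ t → toℕ (μ x) < toℕ t) (sym (invol x)) μx<x)))

    nested-complement : ∀ {y v} → toℕ y < toℕ (μ y) → (toℕ v ≤ toℕ y ⊎ toℕ (μ y) ≤ toℕ v) →
                        toℕ (μ v) ≤ toℕ y ⊎ toℕ (μ y) ≤ toℕ (μ v)
    nested-complement {y} {v} y<μy v-out with toℕ y <? toℕ (μ v) | toℕ (μ v) <? toℕ (μ y)
    ... | no y≮μv | _ = inj₁ (≮⇒≥ y≮μv)
    ... | yes _ | no μv≮μy = inj₂ (≮⇒≥ μv≮μy)
    ... | yes y<μv | yes μv<μy with nested {y} {μ v} y<μv μv<μy
    ...   | y<v , v<μy rewrite invol v = ⊥-elim (excluded v-out)
      where
      excluded : ¬ (toℕ v ≤ toℕ y ⊎ toℕ (μ y) ≤ toℕ v)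
      excluded (inj₁ v≤y) = <⇒≱ y<v v≤y
      excluded (inj₂ μy≤v) = <⇒≱ v<μy μy≤v

    minorArc-closed : ∀ {y v} → toℕ y < toℕ (μ y) → MinorArc (toℕ y) (toℕ (μ y)) (toℕ v) → MinorArc (toℕ y) (toℕ (μ y)) (toℕ (μ v))
    minorArc-closed y<μy (inj₁ (short , y<v , v<μy)) = inj₁ (short , nested y<v v<μy)
    minorArc-closed y<μy (inj₂ (long , v-out)) = inj₂ (long , edge-outside y<μy v-out)

    closedMinorArc-closed : ∀ {y v} → toℕ y < toℕ (μ y) → ClosedMinorArc (toℕ y) (toℕ (μ y)) (toℕ v) →
                            ClosedMinorArc (toℕ y) (toℕ (μ y)) (toℕ (μ v))
    closedMinorArc-closed y<μy (inj₁ (short , y≤v , v≤μy)) = inj₁ (short , edge-closed y<μy y≤v v≤μy)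
    closedMinorArc-closed y<μy (inj₂ (long , v-out)) = inj₂ (long , nested-complement y<μy v-out)

    Exposed : Pt m → Set
    Exposed v = ∀ y → toℕ y < toℕ (μ y) → ¬ MinorArc (toℕ y) (toℕ (μ y)) (toℕ v)

  module _ (m-even : parity m ≡ 0ℙ) (M : NCMatching m) where
    open NCMatching M

    edge-dichotomy : ∀ {y} → toℕ y < toℕ (μ y) → toℕ (μ y) < toℕ y + m ⊎ toℕ y + m < toℕ (μ y)
    edge-dichotomy {y} y<μy with <-cmp (toℕ (μ y)) (toℕ y + m)
    ... | tri< short _ _ = inj₁ short
    ... | tri> _ _ long = inj₂ long
    ... | tri≈ _ diametral _ =
      ⊥-elim (p≢p⁻¹ (parity (toℕ y)) (trans (sym (trans (cong parity diametral) (parity-+m m-even (toℕ y)))) (edge-parity M y<μy)))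

    inside-exposed⇒long : ∀ {y x} → toℕ y < toℕ (μ y) → toℕ y < toℕ x → toℕ x < toℕ (μ y) → Exposed M x →
                          toℕ y + m < toℕ (μ y)
    inside-exposed⇒long {y} y<μy y<x x<μy exposed with edge-dichotomy y<μy
    ... | inj₁ short = ⊥-elim (exposed y y<μy (inj₁ (short , y<x , x<μy)))
    ... | inj₂ long = long

    outside-exposed⇒short : ∀ {y x} → toℕ y < toℕ (μ y) → (toℕ x < toℕ y ⊎ toℕ (μ y) < toℕ x) → Exposed M x →
                            toℕ (μ y) < toℕ y + m
    outside-exposed⇒short {y} y<μy x-out exposed with edge-dichotomy y<μy
    ... | inj₁ short = short
    ... | inj₂ long = ⊥-elim (exposed y y<μy (inj₂ (long , x-out)))

    no-separating-edge : ∀ {y x x′} → Exposed M x → Exposed M x′ → toℕ y < toℕ (μ y) →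
                         toℕ y < toℕ x → toℕ x < toℕ (μ y) → (toℕ x′ < toℕ y ⊎ toℕ (μ y) < toℕ x′) → ⊥
    no-separating-edge ex ex′ y<μy y<x x<μy x′-out =
      <-asym (inside-exposed⇒long y<μy y<x x<μy ex) (outside-exposed⇒short y<μy x′-out ex′)

    partner-below : ∀ {x₁ x₂ z} → toℕ x₂ < toℕ (μ x₂) → Exposed M x₁ → Exposed M x₂ →
                    toℕ x₁ < toℕ z → toℕ z < toℕ x₂ → toℕ (μ z) < toℕ x₂
    partner-below {x₁} {x₂} {z} e₂ ex₁ ex₂ x₁<z z<x₂ with toℕ (μ z) <? toℕ x₂
    ... | yes μz<x₂ = μz<x₂
    ... | no μz≮x₂ with toℕ (μ z) ≤? toℕ (μ x₂)
    ...   | yes μz≤y₂ =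
      ⊥-elim (<⇒≱ z<x₂ (subst (λ t → toℕ x₂ ≤ toℕ t) (invol z) (proj₁ (edge-closed M e₂ (≮⇒≥ μz≮x₂) μz≤y₂))))
    ...   | no μz≰y₂ =
      ⊥-elim (no-separating-edge ex₂ ex₁ (<-≤-trans z<x₂ (≮⇒≥ μz≮x₂)) z<x₂ (<-trans e₂ (≰⇒> μz≰y₂)) (inj₁ x₁<z))

    partner-above : ∀ {x₁ x₂ z} → toℕ x₁ < toℕ (μ x₁) → Exposed M x₁ → Exposed M x₂ →
                    toℕ (μ x₁) < toℕ z → toℕ z < toℕ x₂ → toℕ (μ x₁) < toℕ (μ z)
    partner-above {x₁} {x₂} {z} e₁ ex₁ ex₂ y₁<z z<x₂ with toℕ (μ x₁) <? toℕ (μ z)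
    ... | yes y₁<μz = y₁<μz
    ... | no y₁≮μz with toℕ x₁ ≤? toℕ (μ z)
    ...   | yes x₁≤μz =
      ⊥-elim (<⇒≱ y₁<z (subst (λ t → toℕ t ≤ toℕ (μ x₁)) (invol z) (proj₂ (edge-closed M e₁ x₁≤μz (≮⇒≥ y₁≮μz)))))
    ...   | no x₁≰μz = ⊥-elim (no-separating-edge ex₁ ex₂ μz<μμz μz<x₁ x₁<μμz (inj₂ μμz<x₂))
      where
      μz<x₁ : toℕ (μ z) < toℕ x₁
      μz<x₁ = ≰⇒> x₁≰μz
      x₁<μμz : toℕ x₁ < toℕ (μ (μ z))
      x₁<μμz = subst (λ t → toℕ x₁ < toℕ t) (sym (invol z)) (<-trans e₁ y₁<z)
      μz<μμz : toℕ (μ z) < toℕ (μ (μ z))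
      μz<μμz = <-trans μz<x₁ x₁<μμz
      μμz<x₂ : toℕ (μ (μ z)) < toℕ x₂
      μμz<x₂ = subst (λ t → toℕ t < toℕ x₂) (sym (invol z)) z<x₂

    exposed-sign-< : ∀ {x₁ x₂} → toℕ x₁ < toℕ x₂ → toℕ x₁ < toℕ (μ x₁) → toℕ x₂ < toℕ (μ x₂) →
                     Exposed M x₁ → Exposed M x₂ → sgn m x₁ (μ x₁) ≡ sgn m x₂ (μ x₂)
    exposed-sign-< {x₁} {x₂} x₁<x₂ e₁ e₂ ex₁ ex₂ with <-cmp (toℕ x₂) (toℕ (μ x₁))
    ... | tri≈ _ x₂≡y₁ _ = ⊥-elim (<-asym x₁<x₂ (subst (λ t → toℕ x₂ < toℕ t) (μ-inverse M (sym (toℕ-injective x₂≡y₁))) e₂))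
    ... | tri< x₂<y₁ _ _ = begin
      sgn m x₁ (μ x₁)      ≡⟨ proj₁ (sgn-long e₁ (inside-exposed⇒long e₁ x₁<x₂ x₂<y₁ ex₂)) ⟩
      vertexSign (μ x₁)    ≡⟨ cong signOf (trans (edge-parity M e₁) (sym x₂-parity)) ⟩
      vertexSign x₂        ≡⟨ sym (proj₁ (sgn-short e₂ (outside-exposed⇒short e₂ (inj₁ x₁<x₂) ex₁))) ⟩
      sgn m x₂ (μ x₂)      ∎
      where
      open ≡-Reasoning
      between : Stable M (suc (toℕ x₁)) (toℕ x₂)
      between z x₁<z z<x₂ = proj₁ (nested M x₁<z (<-trans z<x₂ x₂<y₁)) , partner-below e₂ ex₁ ex₂ x₁<z z<x₂
      x₂-parity : parity (toℕ x₂) ≡ parity (toℕ x₁) ⁻¹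
      x₂-parity = trans (stable-parity M (<⇒≤ (toℕ<n x₂)) x₁<x₂ between) (parity-suc (toℕ x₁))
    ... | tri> _ _ y₁<x₂ = begin
      sgn m x₁ (μ x₁)      ≡⟨ proj₁ (sgn-short e₁ (outside-exposed⇒short e₁ (inj₂ y₁<x₂) ex₂)) ⟩
      vertexSign x₁        ≡⟨ cong signOf (sym x₂-parity) ⟩
      vertexSign x₂        ≡⟨ sym (proj₁ (sgn-short e₂ (outside-exposed⇒short e₂ (inj₁ x₁<x₂) ex₁))) ⟩
      sgn m x₂ (μ x₂)      ∎
      where
      open ≡-Reasoning
      between : Stable M (suc (toℕ (μ x₁))) (toℕ x₂)
      between z y₁<z z<x₂ = partner-above e₁ ex₁ ex₂ y₁<z z<x₂ , partner-below e₂ ex₁ ex₂ (<-trans e₁ y₁<z) z<x₂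
      x₂-parity : parity (toℕ x₂) ≡ parity (toℕ x₁)
      x₂-parity = begin
        parity (toℕ x₂)         ≡⟨ stable-parity M (<⇒≤ (toℕ<n x₂)) y₁<x₂ between ⟩
        parity (suc (toℕ (μ x₁))) ≡⟨ parity-suc (toℕ (μ x₁)) ⟩
        parity (toℕ (μ x₁)) ⁻¹  ≡⟨ cong _⁻¹ (edge-parity M e₁) ⟩
        parity (toℕ x₁) ⁻¹ ⁻¹   ≡⟨ ⁻¹-involutive _ ⟩
        parity (toℕ x₁)         ∎

    exposed-sign : ∀ {x₁ x₂} → toℕ x₁ < toℕ (μ x₁) → toℕ x₂ < toℕ (μ x₂) →
                   Exposed M x₁ → Exposed M x₂ → sgn m x₁ (μ x₁) ≡ sgn m x₂ (μ x₂)
    exposed-sign {x₁} {x₂} e₁ e₂ ex₁ ex₂ with <-cmp (toℕ x₁) (toℕ x₂)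
    ... | tri< x₁<x₂ _ _ = exposed-sign-< x₁<x₂ e₁ e₂ ex₁ ex₂
    ... | tri≈ _ x₁≡x₂ _ = cong (λ x → sgn m x (μ x)) (toℕ-injective x₁≡x₂)
    ... | tri> _ _ x₂<x₁ = sym (exposed-sign-< x₂<x₁ e₂ e₁ ex₂ ex₁)

    lower-end : ∀ {x y} → μ x ≡ y → Exposed M x → Exposed M y →
                ∃ λ x′ → toℕ x′ < toℕ (μ x′) × Exposed M x′ × sgn m x y ≡ sgn m x′ (μ x′)
    lower-end {x} {y} refl ex ey with <-cmp (toℕ x) (toℕ (μ x))
    ... | tri< x<y _ _ = x , x<y , ex , refl
    ... | tri≈ _ x≡y _ = ⊥-elim (nofix x (toℕ-injective (sym x≡y)))
    ... | tri> _ _ y<x = μ x , subst (λ t → toℕ (μ x) < toℕ t) (sym (invol x)) y<x , ey ,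
                         trans (sgn-comm m-even (partner-parity M x)) (cong (sgn m (μ x)) (sym (invol x)))

    exposed-edges-sign : ∀ {x₁ y₁ x₂ y₂} → μ x₁ ≡ y₁ → μ x₂ ≡ y₂ →
                         Exposed M x₁ → Exposed M y₁ → Exposed M x₂ → Exposed M y₂ → sgn m x₁ y₁ ≡ sgn m x₂ y₂
    exposed-edges-sign e₁ e₂ ex₁ ey₁ ex₂ ey₂ with lower-end e₁ ex₁ ey₁ | lower-end e₂ ex₂ ey₂
    ... | x₁′ , l₁ , ex₁′ , s₁ | x₂′ , l₂ , ex₂′ , s₂ = trans s₁ (trans (exposed-sign l₁ l₂ ex₁′ ex₂′) (sym s₂))

  SurroundCentre : Pt m → Pt m → Pt m → Pt m → Set
  SurroundCentre a b c d = ∀ {Y Z} → Y < Z → Z < N m →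
    ClosedMinorArc Y Z (toℕ a) → ClosedMinorArc Y Z (toℕ b) → ClosedMinorArc Y Z (toℕ c) → ClosedMinorArc Y Z (toℕ d) → ⊥

  surround-rotate : ∀ {a b c d} → SurroundCentre a b c d → SurroundCentre b c d a
  surround-rotate s Y<Z Z<N ∈b ∈c ∈d ∈a = s Y<Z Z<N ∈a ∈b ∈c ∈d

  surround-reverse : ∀ {a b c d} → SurroundCentre a b c d → SurroundCentre d c b a
  surround-reverse s Y<Z Z<N ∈d ∈c ∈b ∈a = s Y<Z Z<N ∈a ∈b ∈c ∈d

  module _ (M M′ : NCMatching m) where
    private
      μ μ′ : Pt m → Pt m
      μ = NCMatching.μ M
      μ′ = NCMatching.μ M′

    -- An edge of M with a strictly inside its minor arc survives the flip, so either its
    -- closed minor arc contains the whole quadrilateral or it crosses the new edge at a.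
    flip-exposes : ∀ {a b c d} → μ a ≡ b → μ c ≡ d → (μ′ a ≡ c ⊎ μ′ a ≡ d) →
                   (∀ v → v ≢ a → v ≢ b → v ≢ c → v ≢ d → μ′ v ≡ μ v) →
                   SurroundCentre a b c d → Exposed M a
    flip-exposes {a} {c = c} refl refl a↦ unchanged surround y y<μy a-in with closedMinorArc? (toℕ y) (toℕ (μ y)) (toℕ c)
    ... | yes c-in = surround y<μy (toℕ<n (μ y)) (minorArc⇒closed a-in) (minorArc⇒closed (minorArc-closed M y<μy a-in))
                       c-in (closedMinorArc-closed M y<μy c-in)
    ... | no c-out = NCMatching.noncross M′ y a (subst (λ t → Cross m y t a (μ′ a)) (sym μ′y≡μy) (minorArc-cross y<μy a-in a′-out))
      where
      a-ends : toℕ a ≢ toℕ y × toℕ a ≢ toℕ (μ y)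
      a-ends = minorArc-avoids-ends y<μy a-in
      μa-ends : toℕ (μ a) ≢ toℕ y × toℕ (μ a) ≢ toℕ (μ y)
      μa-ends = minorArc-avoids-ends y<μy (minorArc-closed M y<μy a-in)
      ends : ClosedMinorArc (toℕ y) (toℕ (μ y)) (toℕ y) × ClosedMinorArc (toℕ y) (toℕ (μ y)) (toℕ (μ y))
      ends = closedMinorArc-ends y<μy a-in
      μc-out : ¬ ClosedMinorArc (toℕ y) (toℕ (μ y)) (toℕ (μ c))
      μc-out μc-in = c-out (subst (λ t → ClosedMinorArc (toℕ y) (toℕ (μ y)) (toℕ t)) (NCMatching.invol M c) (closedMinorArc-closed M y<μy μc-in))
      a′-out : ¬ ClosedMinorArc (toℕ y) (toℕ (μ y)) (toℕ (μ′ a))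
      a′-out = outside a↦
        where
        outside : ∀ {t} → t ≡ c ⊎ t ≡ μ c → ¬ ClosedMinorArc (toℕ y) (toℕ (μ y)) (toℕ t)
        outside (inj₁ refl) = c-out
        outside (inj₂ refl) = μc-out
      avoids : ∀ {v} → ¬ ClosedMinorArc (toℕ y) (toℕ (μ y)) (toℕ v) → y ≢ v × μ y ≢ v
      avoids v-out = (λ { refl → v-out (proj₁ ends) }) , (λ { refl → v-out (proj₂ ends) })
      μ′y≡μy : μ′ y ≡ μ y
      μ′y≡μy = unchanged y (λ { refl → proj₁ a-ends refl }) (λ { refl → proj₁ μa-ends refl }) (proj₁ (avoids c-out)) (proj₁ (avoids μc-out))

    flip-exposes-all : ∀ {a b c d} → Flip m M M′ a b c d → SurroundCentre a b d c →
                       Exposed M a × Exposed M b × Exposed M c × Exposed M d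
    flip-exposes-all (a↦b , c↦d , a↦′c , b↦′d , _ , unchanged) surround =
      flip-exposes a↦b c↦d (inj₁ a↦′c) unchanged
        (λ Y<Z Z<N ∈a ∈b ∈c ∈d → surround Y<Z Z<N ∈a ∈b ∈d ∈c) ,
      flip-exposes (μ-inverse M a↦b) c↦d (inj₂ b↦′d) (λ v ≢b ≢a ≢c ≢d → unchanged v ≢a ≢b ≢c ≢d)
        (λ Y<Z Z<N ∈b ∈a ∈c ∈d → surround Y<Z Z<N ∈a ∈b ∈d ∈c) ,
      flip-exposes c↦d a↦b (inj₁ (μ-inverse M′ a↦′c)) (λ v ≢c ≢d ≢a ≢b → unchanged v ≢a ≢b ≢c ≢d)
        (λ Y<Z Z<N ∈c ∈d ∈a ∈b → surround Y<Z Z<N ∈a ∈b ∈d ∈c) ,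
      flip-exposes (μ-inverse M c↦d) a↦b (inj₂ (μ-inverse M′ b↦′d)) (λ v ≢d ≢c ≢a ≢b → unchanged v ≢a ≢b ≢c ≢d)
        (λ Y<Z Z<N ∈d ∈c ∈a ∈b → surround Y<Z Z<N ∈a ∈b ∈d ∈c)


  chordLength : ℕ → ℕ
  chordLength d = ⌊ (d ∸ 1) ⊓ (N m ∸ d ∸ 1) /2⌋

  chordLength-reflect : ∀ {d} → d ≤ N m → chordLength (N m ∸ d) ≡ chordLength d
  chordLength-reflect {d} d≤N = trans
    (cong (λ k → ⌊ (N m ∸ d ∸ 1) ⊓ (k ∸ 1) /2⌋) (m∸[m∸n]≡n d≤N))
    (cong ⌊_/2⌋ (⊓-comm (N m ∸ d ∸ 1) (d ∸ 1)))

  chordLength-odd-≤ : ∀ h → chordLength (suc (h + h)) ≤ h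
  chordLength-odd-≤ h = ≤-trans (⌊n/2⌋-mono (m⊓n≤m (h + h) _)) (≤-reflexive (⌊n+n/2⌋≡n h))

  chordLength-odd-tight : ∀ h → 0 < m → h ≤ chordLength (suc (h + h)) → suc (h + h) ≤ m
  chordLength-odd-tight zero 0<m _ = 0<m
  chordLength-odd-tight h@(suc _) _ h≤ℓ = double≤⇒≤ (begin
    suc (h + h) + suc (h + h) ≡⟨ sym (+-suc (h + h) (suc (h + h))) ⟩
    h + h + suc (suc (h + h)) ≤⟨ ≤∸⇒+≤ (s≤s z≤n) 2h≤N∸[2h+2] ⟩
    N m                      ≡⟨ N≡m+m ⟩
    m + m                    ∎)
    where
    open ≤-Reasoning
    2h≤N∸[2h+2] : h + h ≤ N m ∸ suc (suc (h + h))
    2h≤N∸[2h+2] = ≤-trans (≤⌊n/2⌋⇒double≤ h≤ℓ) (≤-trans (m⊓n≤n _ _)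
      (≤-reflexive (trans (∸-+-assoc (N m) (suc (h + h)) 1) (cong (N m ∸_) (+-comm (suc (h + h)) 1)))))

  module _ (m-even : parity m ≡ 0ℙ) where

    odd-gaps-short : ∀ {d₁ d₂ d₃ d₄} → ¬ 2 ∣ d₁ → ¬ 2 ∣ d₂ → ¬ 2 ∣ d₃ → ¬ 2 ∣ d₄ → d₁ + d₂ + d₃ + d₄ ≡ N m →
                     chordLength d₁ + chordLength d₂ + chordLength d₃ + chordLength d₄ ≡ m ∸ 2 →
                     d₁ < m × d₂ < m × d₃ < m × d₄ < m
    odd-gaps-short odd₁ odd₂ odd₃ odd₄ gaps lengths
      with odd⇒suc-double odd₁ | odd⇒suc-double odd₂ | odd⇒suc-double odd₃ | odd⇒suc-double odd₄
    ... | h₁ , refl | h₂ , refl | h₃ , refl | h₄ , refl =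
      short odd₁ (proj₁ ℓ≡h) , short odd₂ (proj₁ (proj₂ ℓ≡h)) ,
      short odd₃ (proj₁ (proj₂ (proj₂ ℓ≡h))) , short odd₄ (proj₂ (proj₂ (proj₂ ℓ≡h)))
      where
      double-sum : ∀ a b c d → suc (a + a) + suc (b + b) + suc (c + c) + suc (d + d) ≡ 2 * suc (suc (a + b + c + d))
      double-sum = solve-∀
      m≡H+2 : m ≡ suc (suc (h₁ + h₂ + h₃ + h₄))
      m≡H+2 = sym (*-cancelˡ-≡ (suc (suc (h₁ + h₂ + h₃ + h₄))) m 2 (trans (sym (double-sum h₁ h₂ h₃ h₄)) gaps))
      ℓ≡h : chordLength (suc (h₁ + h₁)) ≡ h₁ × chordLength (suc (h₂ + h₂)) ≡ h₂ ×
            chordLength (suc (h₃ + h₃)) ≡ h₃ × chordLength (suc (h₄ + h₄)) ≡ h₄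
      ℓ≡h = +-tight₄ (chordLength-odd-≤ h₁) (chordLength-odd-≤ h₂) (chordLength-odd-≤ h₃) (chordLength-odd-≤ h₄)
                     (trans lengths (cong (_∸ 2) m≡H+2))
      short : ∀ {h} → ¬ 2 ∣ suc (h + h) → chordLength (suc (h + h)) ≡ h → suc (h + h) < m
      short {h} odd ℓ≡h = ≤∧≢⇒< (chordLength-odd-tight h (subst (0 <_) (sym m≡H+2) (s≤s z≤n)) (≤-reflexive (sym ℓ≡h)))
        (λ d≡m → 0ℙ≢1ℙ (trans (sym m-even) (trans (cong parity (sym d≡m)) (parity-odd odd))))
        where
        0ℙ≢1ℙ : 0ℙ ≢ 1ℙ
        0ℙ≢1ℙ ()

    odd-complement : ∀ {g} → g ≤ N m → ¬ 2 ∣ g → ¬ 2 ∣ (N m ∸ g)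
    odd-complement {g} g≤N odd 2∣N∸g = p≢p⁻¹ 0ℙ (begin
      0ℙ                           ≡⟨ sym (parity-double m) ⟩
      parity (m + m)               ≡⟨ cong parity (sym N≡m+m) ⟩
      parity (N m)                 ≡⟨ parity-∸ g≤N ⟩
      parity g ℙ.+ parity (N m ∸ g) ≡⟨ cong₂ ℙ._+_ (parity-odd odd) (even⇒parity≡0ℙ 2∣N∸g) ⟩
      1ℙ                           ∎)
      where open ≡-Reasoning

    N∸gap<m⇒m<gap : ∀ {g} → N m ∸ g < m → m < g
    N∸gap<m⇒m<gap {g} N∸g<m = ∸-cancelʳ-< (subst (N m ∸ g <_) (sym N∸m≡m) N∸g<m)
      where
      N∸m≡m : N m ∸ m ≡ m
      N∸m≡m = trans (cong (_∸ m) N≡m+m) (m+n∸n≡m m m)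

    record SortedCentred (w x y z : Pt m) : Set where
      field
        w<x : toℕ w < toℕ x
        x<y : toℕ x < toℕ y
        y<z : toℕ y < toℕ z
        short-wx : toℕ x < toℕ w + m
        short-xy : toℕ y < toℕ x + m
        short-yz : toℕ z < toℕ y + m
        long-wz : toℕ w + m < toℕ z

    record Sides (p q r s : Pt m) : Set where
      constructor sides
      field
        odd-pq : InE m p q
        odd-qr : InE m q r
        odd-rs : InE m r s
        odd-sp : InE m s p
        lengths : len m p q + len m q r + len m r s + len m s p ≡ m ∸ 2

    len-forward : ∀ {a b : Pt m} → toℕ a ≤ toℕ b → len m a b ≡ chordLength (toℕ b ∸ toℕ a)
    len-forward a≤b = cong chordLength (m≤n⇒∣m-n∣≡n∸m a≤b)

    odd-forward : ∀ {a b : Pt m} → toℕ a ≤ toℕ b → InE m a b → ¬ 2 ∣ (toℕ b ∸ toℕ a)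
    odd-forward a≤b odd = odd ∘ subst (2 ∣_) (sym (m≤n⇒∣m-n∣≡n∸m a≤b))

    sorted-sides⇒sortedCentred : ∀ {w x y z} → Inc4 m w x y z → Sides w x y z → SortedCentred w x y z
    sorted-sides⇒sortedCentred {w} {x} {y} {z} (w<x , x<y , y<z) (sides odd-wx odd-xy odd-yz odd-zw lengths) = record
      { w<x = w<x ; x<y = x<y ; y<z = y<z
      ; short-wx = ∸<⇒<+ (<⇒≤ w<x) (proj₁ short)
      ; short-xy = ∸<⇒<+ (<⇒≤ x<y) (proj₁ (proj₂ short))
      ; short-yz = ∸<⇒<+ (<⇒≤ y<z) (proj₁ (proj₂ (proj₂ short)))
      ; long-wz = <∸⇒+< (<⇒≤ w<z) (N∸gap<m⇒m<gap (proj₂ (proj₂ (proj₂ short))))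
      }
      where
      w<z : toℕ w < toℕ z
      w<z = <-trans w<x (<-trans x<y y<z)
      g : ℕ
      g = toℕ z ∸ toℕ w
      g≤N : g ≤ N m
      g≤N = ≤-trans (m∸n≤m (toℕ z) (toℕ w)) (<⇒≤ (toℕ<n z))
      three-gaps : toℕ x ∸ toℕ w + (toℕ y ∸ toℕ x) + (toℕ z ∸ toℕ y) ≡ g
      three-gaps = trans (cong (_+ (toℕ z ∸ toℕ y)) (∸-telescope (<⇒≤ w<x) (<⇒≤ x<y))) (∸-telescope (<⇒≤ (<-trans w<x x<y)) (<⇒≤ y<z))
      odd-zw′ : ¬ 2 ∣ (N m ∸ g)
      odd-zw′ = odd-complement g≤N (odd-zw ∘ subst (2 ∣_) (sym (m≤n⇒∣n-m∣≡n∸m (<⇒≤ w<z))))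
      lengths′ : chordLength (toℕ x ∸ toℕ w) + chordLength (toℕ y ∸ toℕ x) + chordLength (toℕ z ∸ toℕ y) + chordLength (N m ∸ g) ≡ m ∸ 2
      lengths′ = trans (cong₂ _+_ (cong₂ _+_ (cong₂ _+_ (sym (len-forward (<⇒≤ w<x))) (sym (len-forward (<⇒≤ x<y)))) (sym (len-forward (<⇒≤ y<z))))
                                   (trans (chordLength-reflect g≤N) (sym (cong chordLength (m≤n⇒∣n-m∣≡n∸m (<⇒≤ w<z))))))
                       lengths
      short : toℕ x ∸ toℕ w < m × toℕ y ∸ toℕ x < m × toℕ z ∸ toℕ y < m × N m ∸ g < m
      short = odd-gaps-short (odd-forward (<⇒≤ w<x) odd-wx) (odd-forward (<⇒≤ x<y) odd-xy) (odd-forward (<⇒≤ y<z) odd-yz) odd-zw′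
                (trans (cong (_+ (N m ∸ g)) three-gaps) (m+[n∸m]≡n g≤N)) lengths′

    record Centred (p q r s : Pt m) : Set where
      field
        opposite-pq-rs : sgn m p q ≡ sgn m r s
        opposite-qr-sp : sgn m q r ≡ sgn m s p
        adjacent : sgn m q r ≡ - sgn m p q
        surround : SurroundCentre p q r s

    short-arc-members : ∀ {Y Z v} → Z < Y + m → ClosedMinorArc Y Z v → Y ≤ v × v ≤ Z
    short-arc-members _ (inj₁ (_ , member)) = member
    short-arc-members short (inj₂ (long , _)) = ⊥-elim (<-asym short long)

    long-arc-members : ∀ {Y Z v} → Y + m < Z → ClosedMinorArc Y Z v → v ≤ Y ⊎ Z ≤ v
    long-arc-members long (inj₁ (short , _)) = ⊥-elim (<-asym short long)
    long-arc-members _ (inj₂ (_ , member)) = member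

    short-side-stays : ∀ {a b Y Z} → Y + m < Z → b < a + m → a ≤ Y → Z ≤ b → ⊥
    short-side-stays long short a≤Y Z≤b = <-asym long (≤-<-trans Z≤b (<-≤-trans short (+-monoˡ-≤ m a≤Y)))

    sortedCentred-surround : ∀ {w x y z} → SortedCentred w x y z → SurroundCentre w x y z
    sortedCentred-surround {w} {x} {y} {z} sc {Y} {Z} Y<Z Z<N w-in x-in y-in z-in with w-in
    ... | inj₁ (short , Y≤w , _) = <-asym long-wz (≤-<-trans (proj₂ (short-arc-members short z-in)) (<-≤-trans short (+-monoˡ-≤ m Y≤w)))
      where open SortedCentred sc
    ... | inj₂ (long , w-side) = walk w-side
      where
      open SortedCentred sc
      walk : toℕ w ≤ Y ⊎ Z ≤ toℕ w → ⊥
      walk (inj₂ Z≤w) = <-asym (toℕ<n z) (subst (_< toℕ z) (sym N≡m+m) (<-trans (+-monoˡ-< m (≤-<-trans (m≤n+m m Y) (<-≤-trans long Z≤w))) long-wz))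
      walk (inj₁ w≤Y) with long-arc-members long x-in
      ... | inj₂ Z≤x = short-side-stays long short-wx w≤Y Z≤x
      ... | inj₁ x≤Y with long-arc-members long y-in
      ...   | inj₂ Z≤y = short-side-stays long short-xy x≤Y Z≤y
      ...   | inj₁ y≤Y with long-arc-members long z-in
      ...     | inj₂ Z≤z = short-side-stays long short-yz y≤Y Z≤z
      ...     | inj₁ z≤Y = <-asym (+-cancelʳ-< m Y m (<-trans long (subst (Z <_) N≡m+m Z<N))) (≤-<-trans (m≤n+m m (toℕ w)) (<-≤-trans long-wz z≤Y))

    sorted-centred : ∀ {w x y z} → Inc4 m w x y z → Sides w x y z → Centred w x y z
    sorted-centred {w} {x} {y} {z} inc sd = record
      { opposite-pq-rs = begin
          sgn m w x       ≡⟨ proj₁ (sgn-short w<x short-wx) ⟩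
          vertexSign w    ≡⟨ cong signOf (sym (flip-flip x-parity y-parity)) ⟩
          vertexSign y    ≡⟨ sym (proj₁ (sgn-short y<z short-yz)) ⟩
          sgn m y z       ∎
      ; opposite-qr-sp = begin
          sgn m x y       ≡⟨ proj₁ (sgn-short x<y short-xy) ⟩
          vertexSign x    ≡⟨ cong signOf (sym (flip-flip y-parity z-parity)) ⟩
          vertexSign z    ≡⟨ sym (proj₂ (sgn-long (<-trans w<x (<-trans x<y y<z)) long-wz)) ⟩
          sgn m z w       ∎
      ; adjacent = begin
          sgn m x y       ≡⟨ proj₁ (sgn-short x<y short-xy) ⟩
          vertexSign x    ≡⟨ cong signOf x-parity ⟩
          signOf (parity (toℕ w) ⁻¹) ≡⟨ signOf-⁻¹ (parity (toℕ w)) ⟩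
          - vertexSign w  ≡⟨ cong -_ (sym (proj₁ (sgn-short w<x short-wx))) ⟩
          - sgn m w x     ∎
      ; surround = sortedCentred-surround sc
      }
      where
      open ≡-Reasoning
      open Sides sd
      sc : SortedCentred w x y z
      sc = sorted-sides⇒sortedCentred inc sd
      open SortedCentred sc
      x-parity : parity (toℕ x) ≡ parity (toℕ w) ⁻¹
      x-parity = InE-parity {w} {x} odd-pq
      y-parity : parity (toℕ y) ≡ parity (toℕ x) ⁻¹
      y-parity = InE-parity {x} {y} odd-qr
      z-parity : parity (toℕ z) ≡ parity (toℕ y) ⁻¹
      z-parity = InE-parity {y} {z} odd-rs

    InE-sym : ∀ (x y : Pt m) → InE m x y → InE m y x
    InE-sym x y odd = odd ∘ subst (2 ∣_) (∣-∣-comm (toℕ y) (toℕ x))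

    len-comm : ∀ (x y : Pt m) → len m x y ≡ len m y x
    len-comm x y = cong chordLength (∣-∣-comm (toℕ x) (toℕ y))

    InE⇒sgn-comm : ∀ (x y : Pt m) → InE m x y → sgn m x y ≡ sgn m y x
    InE⇒sgn-comm x y odd = sgn-comm m-even (InE-parity {x} {y} odd)

    sides-rotate : ∀ {p q r s} → Sides p q r s → Sides q r s p
    sides-rotate {p} {q} (sides pq qr rs sp lengths) = sides qr rs sp pq (trans (rotate-sum (len m p q) _ _ _) lengths)
      where
      rotate-sum : ∀ a b c d → b + c + d + a ≡ a + b + c + d
      rotate-sum = solve-∀

    sides-reverse : ∀ {p q r s} → Sides p q r s → Sides s r q p
    sides-reverse {p} {q} {r} {s} (sides pq qr rs sp lengths) = sides (InE-sym r s rs) (InE-sym q r qr) (InE-sym p q pq) (InE-sym s p sp) (begin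
      len m s r + len m r q + len m q p + len m p s ≡⟨ cong₂ _+_ (cong₂ _+_ (cong₂ _+_ (len-comm s r) (len-comm r q)) (len-comm q p)) (len-comm p s) ⟩
      len m r s + len m q r + len m p q + len m s p ≡⟨ reverse-sum (len m p q) _ _ _ ⟩
      len m p q + len m q r + len m r s + len m s p ≡⟨ lengths ⟩
      m ∸ 2                                        ∎)
      where
      open ≡-Reasoning
      reverse-sum : ∀ a b c d → c + b + a + d ≡ a + b + c + d
      reverse-sum = solve-∀

    centred-rotate : ∀ {p q r s} → Centred p q r s → Centred q r s p
    centred-rotate c = record
      { opposite-pq-rs = opposite-qr-sp
      ; opposite-qr-sp = sym opposite-pq-rs
      ; adjacent = trans (sym opposite-pq-rs) (trans (sym (ℤₚ.neg-involutive _)) (cong -_ (sym adjacent)))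
      ; surround = surround-rotate surround
      }
      where open Centred c

    centred-reverse : ∀ {p q r s} → Sides p q r s → Centred p q r s → Centred s r q p
    centred-reverse {p} {q} {r} {s} sd c = record
      { opposite-pq-rs = trans (sym (InE⇒sgn-comm r s odd-rs)) (trans (sym opposite-pq-rs) (InE⇒sgn-comm p q odd-pq))
      ; opposite-qr-sp = trans (sym (InE⇒sgn-comm q r odd-qr)) (trans opposite-qr-sp (InE⇒sgn-comm s p odd-sp))
      ; adjacent = trans (sym (InE⇒sgn-comm q r odd-qr)) (trans adjacent (cong -_ (trans opposite-pq-rs (InE⇒sgn-comm r s odd-rs))))
      ; surround = surround-reverse surround
      }
      where
      open Sides sd
      open Centred c

    centred : ∀ {p q r s} → Centered4gon m p q r s → Centred p q r s
    centred {p} {q} {r} {s} (convex , pq , qr , rs , sp , lengths) = from-convex convex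
      where
      sd : Sides p q r s
      sd = sides pq qr rs sp lengths
      rotate : ∀ {p q r s} → Centred p q r s → Centred q r s p
      rotate = centred-rotate
      reversed : ∀ {p q r s} → Inc4 m p q r s → Sides p q r s → Centred s r q p
      reversed o sides′ = centred-reverse sides′ (sorted-centred o sides′)
      -- The eight cases of ConvexQuad are the rotations and reflections of a sorted quadrilateral.
      from-convex : ConvexQuad m p q r s → Centred p q r s
      from-convex (inj₁ o) = sorted-centred o sd
      from-convex (inj₂ (inj₁ o)) = rotate (rotate (rotate (sorted-centred o (sides-rotate sd))))
      from-convex (inj₂ (inj₂ (inj₁ o))) = rotate (rotate (sorted-centred o (sides-rotate (sides-rotate sd))))
      from-convex (inj₂ (inj₂ (inj₂ (inj₁ o)))) = rotate (sorted-centred o (sides-rotate (sides-rotate (sides-rotate sd))))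
      from-convex (inj₂ (inj₂ (inj₂ (inj₂ (inj₁ o))))) = reversed o (sides-reverse sd)
      from-convex (inj₂ (inj₂ (inj₂ (inj₂ (inj₂ (inj₁ o)))))) = rotate (reversed o (sides-rotate (sides-reverse sd)))
      from-convex (inj₂ (inj₂ (inj₂ (inj₂ (inj₂ (inj₂ (inj₁ o))))))) =
        rotate (rotate (reversed o (sides-rotate (sides-rotate (sides-reverse sd)))))
      from-convex (inj₂ (inj₂ (inj₂ (inj₂ (inj₂ (inj₂ (inj₂ o))))))) =
        rotate (rotate (rotate (reversed o (sides-rotate (sides-rotate (sides-rotate (sides-reverse sd)))))))

    edgeWeight : Pt m → Pt m → ℤ
    edgeWeight i j = if toℕ i <ᵇ toℕ j then sgn m i j ℤ.* + len m i j else + 0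

    w≡sum : ∀ M → w m M ≡ sum (λ i → edgeWeight i (NCMatching.μ M i))
    w≡sum M = sumAt-tabulate (λ i → edgeWeight i (NCMatching.μ M i)) (λ i → i)

    edgeWeight-pair : ∀ {u v : Pt m} → u ≢ v → sgn m u v ≡ sgn m v u → edgeWeight u v ℤ.+ edgeWeight v u ≡ sgn m u v ℤ.* + len m u v
    edgeWeight-pair {u} {v} u≢v comm with <-cmp (toℕ u) (toℕ v)
    ... | tri< u<v _ _ = trans (cong₂ ℤ._+_ (if-<ᵇ-true u<v) (if-<ᵇ-false (<⇒≤ u<v))) (ℤₚ.+-identityʳ _)
    ... | tri≈ _ u≡v _ = ⊥-elim (u≢v (toℕ-injective u≡v))
    ... | tri> _ _ v<u = trans (cong₂ ℤ._+_ (if-<ᵇ-false (<⇒≤ v<u)) (if-<ᵇ-true v<u))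
                               (trans (ℤₚ.+-identityˡ _) (cong₂ (λ s ℓ → s ℤ.* + ℓ) (sym comm) (len-comm v u)))

    matched-pair : ∀ M {u v} → NCMatching.μ M u ≡ v →
                   edgeWeight u (NCMatching.μ M u) ℤ.+ edgeWeight v (NCMatching.μ M v) ≡ sgn m u v ℤ.* + len m u v
    matched-pair M {u} refl = trans
      (cong (λ t → edgeWeight u (μ u) ℤ.+ edgeWeight (μ u) t) (invol u))
      (edgeWeight-pair (λ u≡μu → nofix u (sym u≡μu)) (sgn-comm m-even (partner-parity M u)))
      where open NCMatching M

    flip-exchange : ∀ {M M′ a b c d} → Flip m M M′ a b c d →
                    w m M′ ℤ.+ (sgn m a b ℤ.* + len m a b ℤ.+ sgn m c d ℤ.* + len m c d) ≡
                    w m M ℤ.+ (sgn m a c ℤ.* + len m a c ℤ.+ sgn m b d ℤ.* + len m b d)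
    flip-exchange {M} {M′} {a} {b} {c} {d} (a↦b , c↦d , a↦′c , b↦′d , (a≢c , a≢d , b≢c , b≢d) , unchanged) = begin
      w m M′ ℤ.+ (sgn m a b ℤ.* + len m a b ℤ.+ sgn m c d ℤ.* + len m c d)
        ≡⟨ cong₂ ℤ._+_ (w≡sum M′) (sym (trans (regroup-ab-cd (G a) (G b) (G c) (G d)) (cong₂ ℤ._+_ (matched-pair M a↦b) (matched-pair M c↦d)))) ⟩
      sum F ℤ.+ sumAt G (a ∷ b ∷ c ∷ d ∷ [])
        ≡⟨ sum-agree-off-list (a ∷ b ∷ c ∷ d ∷ []) ((a≢b ∷ a≢c ∷ a≢d ∷ []) ∷ (b≢c ∷ b≢d ∷ []) ∷ (c≢d ∷ []) ∷ [] ∷ []) F≈G ⟩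
      sum G ℤ.+ sumAt F (a ∷ b ∷ c ∷ d ∷ [])
        ≡⟨ cong₂ ℤ._+_ (sym (w≡sum M))
                       (trans (regroup-ac-bd (F a) (F b) (F c) (F d)) (cong₂ ℤ._+_ (matched-pair M′ a↦′c) (matched-pair M′ b↦′d))) ⟩
      w m M ℤ.+ (sgn m a c ℤ.* + len m a c ℤ.+ sgn m b d ℤ.* + len m b d) ∎
      where
      open ≡-Reasoning
      F G : Vector ℤ (N m)
      F i = edgeWeight i (NCMatching.μ M′ i)
      G i = edgeWeight i (NCMatching.μ M i)
      a≢b : a ≢ b
      a≢b refl = NCMatching.nofix M a a↦b
      c≢d : c ≢ d
      c≢d refl = NCMatching.nofix M c c↦d
      F≈G : ∀ j → j ∉ a ∷ b ∷ c ∷ d ∷ [] → F j ≡ G j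
      F≈G j j∉ = cong (edgeWeight j)
        (unchanged j (j∉ ∘ here) (j∉ ∘ there ∘ here) (j∉ ∘ there ∘ there ∘ here) (j∉ ∘ there ∘ there ∘ there ∘ here))
      regroup-ab-cd : ∀ x y z t → x ℤ.+ (y ℤ.+ (z ℤ.+ (t ℤ.+ + 0))) ≡ (x ℤ.+ y) ℤ.+ (z ℤ.+ t)
      regroup-ab-cd = ℤ-Solver.solve-∀
      regroup-ac-bd : ∀ x y z t → x ℤ.+ (y ℤ.+ (z ℤ.+ (t ℤ.+ + 0))) ≡ (x ℤ.+ z) ℤ.+ (y ℤ.+ t)
      regroup-ac-bd = ℤ-Solver.solve-∀

    centred-flip-signs : ∀ {M M′ a b c d} → CenteredFlip m M M′ a b c d →
                         sgn m a b ≡ - sgn m a c × sgn m c d ≡ - sgn m a c × sgn m b d ≡ sgn m a c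
    centred-flip-signs {a = a} {b} {c} {d} (_ , quad@(_ , _ , _ , odd-dc , odd-ca , _)) = sgn-ab , sgn-cd , sgn-bd
      where
      open ≡-Reasoning
      open Centred (centred quad)
      sgn-bd : sgn m b d ≡ sgn m a c
      sgn-bd = trans opposite-qr-sp (InE⇒sgn-comm c a odd-ca)
      sgn-ab : sgn m a b ≡ - sgn m a c
      sgn-ab = begin
        sgn m a b       ≡⟨ sym (ℤₚ.neg-involutive _) ⟩
        - - sgn m a b   ≡⟨ cong -_ (sym adjacent) ⟩
        - sgn m b d     ≡⟨ cong -_ sgn-bd ⟩
        - sgn m a c     ∎
      sgn-cd : sgn m c d ≡ - sgn m a c
      sgn-cd = trans (sym (InE⇒sgn-comm d c odd-dc)) (trans (sym opposite-pq-rs) sgn-ab)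

    flip-weight : ∀ {M M′ a b c d} → CenteredFlip m M M′ a b c d → w m M′ ≡ w m M ℤ.+ sgn m a c ℤ.* + (m ∸ 2)
    flip-weight {M} {M′} {a} {b} {c} {d} cflip@(flip , _ , _ , _ , _ , _ , lengths) with centred-flip-signs {M} {M′} {a} {b} {c} {d} cflip
    ... | sgn-ab , sgn-cd , sgn-bd = begin
      w m M′
        ≡⟨ exchange-signs (w m M′) (w m M) s (+ len m a b) (+ len m c d) (+ len m a c) (+ len m b d) signed-exchange ⟩
      w m M ℤ.+ s ℤ.* (+ len m a b ℤ.+ + len m c d ℤ.+ + len m a c ℤ.+ + len m b d)
        ≡⟨ cong (λ t → w m M ℤ.+ s ℤ.* t) total-length ⟩
      w m M ℤ.+ s ℤ.* + (m ∸ 2) ∎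
      where
      open ≡-Reasoning
      s : ℤ
      s = sgn m a c
      signed-exchange : w m M′ ℤ.+ (- s ℤ.* + len m a b ℤ.+ - s ℤ.* + len m c d) ≡ w m M ℤ.+ (s ℤ.* + len m a c ℤ.+ s ℤ.* + len m b d)
      signed-exchange = subst₂ (λ x y → w m M′ ℤ.+ (x ℤ.* + len m a b ℤ.+ y ℤ.* + len m c d) ≡ w m M ℤ.+ (s ℤ.* + len m a c ℤ.+ s ℤ.* + len m b d))
        sgn-ab sgn-cd (subst (λ y → w m M′ ℤ.+ (sgn m a b ℤ.* + len m a b ℤ.+ sgn m c d ℤ.* + len m c d) ≡ w m M ℤ.+ (s ℤ.* + len m a c ℤ.+ y ℤ.* + len m b d))
          sgn-bd (flip-exchange {M} {M′} {a} {b} {c} {d} flip))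
      sides-order : ∀ x y z t → x ℤ.+ y ℤ.+ z ℤ.+ t ≡ x ℤ.+ t ℤ.+ y ℤ.+ z
      sides-order = ℤ-Solver.solve-∀
      total-length : + len m a b ℤ.+ + len m c d ℤ.+ + len m a c ℤ.+ + len m b d ≡ + (m ∸ 2)
      total-length = begin
        + len m a b ℤ.+ + len m c d ℤ.+ + len m a c ℤ.+ + len m b d ≡⟨ cong₂ (λ x y → + len m a b ℤ.+ + x ℤ.+ + y ℤ.+ + len m b d) (len-comm c d) (len-comm a c) ⟩
        + len m a b ℤ.+ + len m d c ℤ.+ + len m c a ℤ.+ + len m b d ≡⟨ sides-order (+ len m a b) (+ len m d c) (+ len m c a) (+ len m b d) ⟩
        + len m a b ℤ.+ + len m b d ℤ.+ + len m d c ℤ.+ + len m c a ≡⟨ sym (pos-+₄ (len m a b) (len m b d) (len m d c) (len m c a)) ⟩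
        + (len m a b + len m b d + len m d c + len m c a)             ≡⟨ cong +_ lengths ⟩
        + (m ∸ 2)                                                     ∎

    flip-reverse : ∀ {M M′ a b c d} → Flip m M M′ a b c d → Flip m M′ M a c b d
    flip-reverse {M} {M′} {a} {b} {c} {d} (a↦b , c↦d , a↦′c , b↦′d , (a≢c , a≢d , b≢c , b≢d) , unchanged) =
      a↦′c , b↦′d , a↦b , c↦d , (a≢b , a≢d , b≢c ∘ sym , c≢d) , (λ v v≢a v≢c v≢b v≢d → sym (unchanged v v≢a v≢b v≢c v≢d))
      where
      a≢b : a ≢ b
      a≢b refl = NCMatching.nofix M a a↦b
      c≢d : c ≢ d
      c≢d refl = NCMatching.nofix M c c↦d

    successive-flips-alternate : ∀ {M₀ M₁ M₂ a b c d a′ b′ c′ d′} →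
      CenteredFlip m M₀ M₁ a b c d → CenteredFlip m M₁ M₂ a′ b′ c′ d′ → sgn m a′ c′ ≡ - sgn m a c
    successive-flips-alternate {M₀} {M₁} {M₂} {a} {b} {c} {d} {a′} {b′} {c′} {d′} first@(flip₁ , quad₁) second@(flip₂ , quad₂) = begin
      sgn m a′ c′     ≡⟨ sym (proj₂ (proj₂ (centred-flip-signs {M₁} {M₂} {a′} {b′} {c′} {d′} second))) ⟩
      sgn m b′ d′     ≡⟨ Centred.adjacent (centred {a′} {b′} {d′} {c′} quad₂) ⟩
      - sgn m a′ b′   ≡⟨ cong -_ (sym same-face) ⟩
      - sgn m a c     ∎
      where
      open ≡-Reasoning
      surround₁ : SurroundCentre a b d c
      surround₁ = Centred.surround (centred {a} {b} {d} {c} quad₁)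
      exposed₁ : Exposed M₁ a × Exposed M₁ c × Exposed M₁ b × Exposed M₁ d
      exposed₁ = flip-exposes-all M₁ M₀ (flip-reverse {M₀} {M₁} {a} {b} {c} {d} flip₁) (λ Y<Z Z<N ∈a ∈c ∈d ∈b → surround₁ Y<Z Z<N ∈a ∈b ∈d ∈c)
      exposed₂ : Exposed M₁ a′ × Exposed M₁ b′ × Exposed M₁ c′ × Exposed M₁ d′
      exposed₂ = flip-exposes-all M₁ M₂ flip₂ (Centred.surround (centred {a′} {b′} {d′} {c′} quad₂))
      same-face : sgn m a c ≡ sgn m a′ b′
      same-face = exposed-edges-sign m-even M₁ (proj₁ (proj₂ (proj₂ flip₁))) (proj₁ flip₂)
        (proj₁ exposed₁) (proj₁ (proj₂ exposed₁)) (proj₁ exposed₂) (proj₁ (proj₂ exposed₂))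

    sgn≢-sgn : ∀ (x y : Pt m) → sgn m x y ≢ - sgn m x y
    sgn≢-sgn x y eq = signOf≢-signOf (parity (toℕ (tail m x y))) (trans (sym (sgn≡vertexSign-tail x y)) (trans eq (cong -_ (sgn≡vertexSign-tail x y))))

    centred-sign-pattern : ∀ p q r s → Centered4gon m p q r s →
                           sgn m p q ≡ sgn m r s × sgn m q r ≡ sgn m s p × sgn m p q ≢ sgn m q r
    centred-sign-pattern p q r s quad = opposite-pq-rs , opposite-qr-sp , λ eq → sgn≢-sgn p q (trans eq adjacent)
      where open Centred (centred {p} {q} {r} {s} quad)

    centred-flip-weight : ∀ M M′ a b c d → CenteredFlip m M M′ a b c d →
                          (sgn m a c ≡ - (+ 1) → w m M′ ≡ w m M ℤ.- + (m ∸ 2)) × (sgn m a c ≡ + 1 → w m M′ ≡ w m M ℤ.+ + (m ∸ 2))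
    centred-flip-weight M M′ a b c d cflip =
      (λ ac≡-1 → trans weight (trans (cong (λ s → w m M ℤ.+ s ℤ.* + (m ∸ 2)) ac≡-1) (cong (λ t → w m M ℤ.+ t) (ℤₚ.-1*i≡-i _)))) ,
      (λ ac≡1 → trans weight (trans (cong (λ s → w m M ℤ.+ s ℤ.* + (m ∸ 2)) ac≡1) (cong (λ t → w m M ℤ.+ t) (ℤₚ.*-identityˡ _))))
      where
      weight : w m M′ ≡ w m M ℤ.+ sgn m a c ℤ.* + (m ∸ 2)
      weight = flip-weight {M} {M′} {a} {b} {c} {d} cflip

    successive-flips-signs : ∀ M₀ M₁ M₂ a b c d a′ b′ c′ d′ → CenteredFlip m M₀ M₁ a b c d → CenteredFlip m M₁ M₂ a′ b′ c′ d′ →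
                             ∀ {ε} → sgn m a c ≡ ε → sgn m a′ c′ ≡ - ε × sgn m b′ d′ ≡ - ε
    successive-flips-signs M₀ M₁ M₂ a b c d a′ b′ c′ d′ first second {ε} ac≡ε =
      a′c′ , trans (proj₂ (proj₂ (centred-flip-signs {M₁} {M₂} {a′} {b′} {c′} {d′} second))) a′c′
      where
      a′c′ : sgn m a′ c′ ≡ - ε
      a′c′ = trans (successive-flips-alternate {M₀} {M₁} {M₂} {a} {b} {c} {d} {a′} {b′} {c′} {d′} first second) (cong -_ ac≡ε)

lemma11 : (m : ℕ) → 2 ≤ m → 2 ∣ m →
    ((p q r s : Pt m) → Centered4gon m p q r s →
        sgn m p q ≡ sgn m r s × sgn m q r ≡ sgn m s p × sgn m p q ≢ sgn m q r)
    × ((M M' : NCMatching m) (a b c d : Pt m) → CenteredFlip m M M' a b c d →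
        ((sgn m a c ≡ - (+ 1) → sgn m b d ≡ - (+ 1) → w m M' ≡ w m M ℤ.- + (m ∸ 2))
         × (sgn m a c ≡ + 1 → sgn m b d ≡ + 1 → w m M' ≡ w m M ℤ.+ + (m ∸ 2))))
    × ((M₀ M₁ M₂ : NCMatching m) (a b c d a′ b′ c′ d′ : Pt m) →
        CenteredFlip m M₀ M₁ a b c d → CenteredFlip m M₁ M₂ a′ b′ c′ d′ →
        ((sgn m a c ≡ - (+ 1) × sgn m b d ≡ - (+ 1) → sgn m a′ c′ ≡ + 1 × sgn m b′ d′ ≡ + 1)
         × (sgn m a c ≡ + 1 × sgn m b d ≡ + 1 → sgn m a′ c′ ≡ - (+ 1) × sgn m b′ d′ ≡ - (+ 1))))
lemma11 m _ 2∣m =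
  centred-sign-pattern m m-even ,
  (λ M M′ a b c d cflip → let (down , up) = centred-flip-weight m m-even M M′ a b c d cflip
                          in (λ ac≡-1 _ → down ac≡-1) , (λ ac≡1 _ → up ac≡1)) ,
  (λ M₀ M₁ M₂ a b c d a′ b′ c′ d′ first second →
     let alternate = successive-flips-signs m m-even M₀ M₁ M₂ a b c d a′ b′ c′ d′ first second
     in (λ (ac≡-1 , _) → alternate ac≡-1) , (λ (ac≡1 , _) → alternate ac≡1))
  where
  m-even : parity m ≡ 0ℙ
  m-even = even⇒parity≡0ℙ 2∣m
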